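{- Let $r$ be a positive integer and $y_0=\Phi^t_{r-1}$. For $-1\le j\le r-1$, $$\Phi^t_{j}(z) = \frac{1}{x_{r+2}} \sum_{i=0}^{r-1-j} A^{(j)}_{i} z^i \mathcal{D}_q^i y_0 + \delta_{j, -1},$$ where, for $0\le i\le r-1-j$, $$A^{(j)}_i = \sum_{m=i}^{r-1-j} (x_{r+2-m} - x_1 x_{r+1-m}) S_q(m, i) + x_1 x_{j+2} S_q(r-1-j, i).$$
   Context: $q$ is a formal parameter, $[n]=(1-q^n)/(1-q)$. For an index $\mathbf k=(k_1,\dots,k_l)$ of positive integers, $Li_{\mathbf k;q}(z)=\sum_{m_1>\cdots>m_l\ge1}\frac{z^{m_1}}{[m_1]^{k_1}\cdots[m_l]^{k_l}}$, $Li^t_{\mathbf k;q}(z)=\sum_{\mathbf p}Li_{\mathbf p;q}(z)t^{l-\mathrm{dep}(\mathbf p)}$, $\mathbf p$ running over indices $(k_1\,\square\cdots\square\,k_l)$ with each $\square$ filled by ``$,$'' or ``$+$''. The $i$-height is $\#\{j:k_j\ge i+1\}$. For $k,l,h_1,\dots,h_r\ge0$ and $-1\le j\le r-1$, $I_j(k,l,h_1,\dots,h_r)$ is the set of indices of weight $k$, depth $l$, $i$-height $h_i$ with $k_1\ge j+2$; $G^t_j=\sum_{\mathbf k\in I_j}Li^t_{\mathbf k;q}(z)$ (empty sum $0$), $G^t=G^t_{ -1}$, $G^t(0,\dots,0;z)=1$. For variables $x_1,\dots,x_{r+2}$, $\Phi^t_j(z)=\sum_{k,l,h_i\ge0}G^t_j(k,l,h_1,\dots,h_r;z)x_1^{k-l-\sum_i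 h_i}x_2^{l-h_1}x_3^{h_1-h_2}\cdots x_{r+1}^{h_{r-1}-h_r}x_{r+2}^{h_r}$. $(\mathcal D_q f)(z)=\frac{f(z)-f(qz)}{(1-q)z}$. The $q$-Stirling numbers: $S_q(0,0)=1$, $S_q(n,k)=q^{k-1}S_q(n-1,k-1)+[k]S_q(n-1,k)$ for $0<k\le n$, $0$ otherwise. -}

module Defs where

open import Algebra.Bundles using (CommutativeRing)
open import Data.Nat using (ℕ; zero; suc; _+_; _∸_; _≤ᵇ_; _≡ᵇ_; pred)
open import Data.Fin using (Fin; toℕ) renaming (zero to fz; suc to fs)
open import Data.Bool using (Bool; true; false; if_then_else_; _∧_)
open import Data.Maybe using (Maybe; just; nothing)
import Data.Maybe as Maybe
open import Data.List using (List; []; _∷_; map; _++_; concatMap; upTo; allFin; length; foldr; drop)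

eqList : List ℕ → List ℕ → Bool
eqList [] [] = true
eqList (a ∷ as) (b ∷ bs) = (a ≡ᵇ b) ∧ eqList as bs
eqList _ _ = false

sumℕ : List ℕ → ℕ
sumℕ = foldr _+_ 0

-- all indices (compositions) of weight k and depth l (positive parts)
comps : ℕ → ℕ → List (List ℕ)
comps zero zero = [] ∷ []
comps (suc k) zero = []
comps k (suc l) = concatMap (λ p → map (suc p ∷_) (comps (k ∸ suc p) l)) (upTo k)

-- i-height list (h_1, ..., h_r) of an index: h_i = #{j : k_j ≥ i+1}
count : ℕ → List ℕ → ℕ
count i [] = 0
count i (k ∷ ks) = (if suc i ≤ᵇ k then 1 else 0) + count i ks

heights : ℕ → List ℕ → List ℕ
heights r ks = map (λ i → count (suc i) ks) (upTo r)

-- condition "k_1 ≥ j+2" where j' = j+1 (so j' ∈ {0,…,r});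
-- the empty index (weight 0) only belongs to I_{-1}, i.e. j' = 0
headOK : ℕ → List ℕ → Bool
headOK j' [] = j' ≡ᵇ 0
headOK j' (k ∷ _) = suc j' ≤ᵇ k

-- all indices (k_1 □ ⋯ □ k_l), □ ∈ {",", "+"}
compAcc : ℕ → List ℕ → List (List ℕ)
compAcc a [] = (a ∷ []) ∷ []
compAcc a (k ∷ ks) = map (a ∷_) (compAcc k ks) ++ compAcc (a + k) ks

compressions : List ℕ → List (List ℕ)
compressions [] = [] ∷ []
compressions (k ∷ ks) = compAcc k ks

toFin? : (N a : ℕ) → Maybe (Fin N)
toFin? zero _ = nothing
toFin? (suc N) zero = just fz
toFin? (suc N) (suc a) = Maybe.map fs (toFin? N a)

module Q {c ℓ} (R : CommutativeRing c ℓ) where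
  open CommutativeRing R renaming (_+_ to _⊞_)

  pow : Carrier → ℕ → Carrier
  pow x zero = 1#
  pow x (suc n) = x * pow x n

  sumR : List Carrier → Carrier
  sumR = foldr _⊞_ 0#

  qint : Carrier → ℕ → Carrier
  qint q n = sumR (map (pow q) (upTo n))

  Sq : Carrier → ℕ → ℕ → Carrier
  Sq q zero zero = 1#
  Sq q zero (suc k) = 0#
  Sq q (suc n) zero = 0#
  Sq q (suc n) (suc k) = pow q k * Sq q n k ⊞ qint q (suc k) * Sq q n (suc k)

  -- Formal power series in x_1,…,x_N and z: coefficient of x^α z^n
  Series : ℕ → Set c
  Series N = (Fin N → ℕ) → ℕ → Carrier

  _≋_ : ∀ {N} → Series N → Series N → Set ℓ
  F ≋ G = ∀ α n → F α n ≈ G α n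

  _⊕_ : ∀ {N} → Series N → Series N → Series N
  (F ⊕ G) α n = F α n ⊞ G α n

  _⊖_ : ∀ {N} → Series N → Series N → Series N
  (F ⊖ G) α n = F α n - G α n

  _·_ : ∀ {N} → Carrier → Series N → Series N
  (a · F) α n = a * F α n

  zeroS : ∀ {N} → Series N
  zeroS α n = 0#

  oneS : ∀ {N} → Series N
  oneS {N} α n = if sumℕ (map α (allFin N)) ≡ᵇ 0 then (if n ≡ᵇ 0 then 1# else 0#) else 0#

  ΣS : ∀ {N} → List (Series N) → Series N
  ΣS = foldr _⊕_ zeroS

  -- multiplication by the variable x_a (a is 1-based, 1 ≤ a ≤ N)
  xmul : ∀ {N} → ℕ → Series N → Series N
  xmul {N} a F α n with toFin? N (pred a)
  ... | nothing = 0#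
  ... | just p = if α p ≡ᵇ 0 then 0#
                 else F (λ i → if toℕ i ≡ᵇ toℕ p then pred (α i) else α i) n

  zmul : ∀ {N} → Series N → Series N
  zmul F α zero = 0#
  zmul F α (suc n) = F α n

  -- q-derivative in z: (D_q f)(z) = (f(z) - f(qz)) / ((1-q) z),
  -- whose z^n coefficient is [n+1] f_{n+1}
  Dq : ∀ {N} → Carrier → Series N → Series N
  Dq q F α n = qint q (suc n) * F α (suc n)

  iter : ∀ {a} {A : Set a} → ℕ → (A → A) → A → A
  iter zero f x = x
  iter (suc n) f x = f (iter n f x)

  zDi : ∀ {N} → Carrier → ℕ → Series N → Series N
  zDi q i F = iter i zmul (iter i (Dq q) F)

  module L (q t : Carrier) (inv : ℕ → Carrier) where
    -- inv m is the inverse of [m] (for m ≥ 1)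
    tailCoef : List ℕ → ℕ → Carrier
    tailCoef [] n = 1#
    tailCoef (p ∷ ps) n = sumR (map (λ m → pow (inv (suc m)) p * tailCoef ps (suc m)) (upTo (n ∸ 1)))

    -- coefficient of z^n in Li_{k;q}(z)
    liCoef : List ℕ → ℕ → Carrier
    liCoef [] n = if n ≡ᵇ 0 then 1# else 0#
    liCoef (p ∷ ps) zero = 0#
    liCoef (p ∷ ps) (suc n) = pow (inv (suc n)) p * tailCoef ps (suc n)

    -- coefficient of z^n in Li^t_{k;q}(z)
    liTCoef : List ℕ → ℕ → Carrier
    liTCoef ks n = sumR (map (λ p → liCoef p n * pow t (length ks ∸ length p)) (compressions ks))

    -- coefficient of z^n in G^t_j(k,l,h_1..h_r; z), with j' = j+1
    G : (r j' k l : ℕ) → List ℕ → ℕ → Carrier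
    G r j' k l hs n = sumR (map (λ ks → if eqList (heights r ks) hs ∧ headOK j' ks
                                         then liTCoef ks n else 0#) (comps k l))

    suffixSums : List ℕ → List ℕ
    suffixSums [] = []
    suffixSums (a ∷ as) = (a + sumℕ as) ∷ suffixSums as

    -- coefficient of x^α z^n in Φ^t_j(z) (N = r+2, j' = j+1): the exponent
    -- vector (a_1,…,a_{r+2}) determines k,l,h by
    --   h_i = a_{i+2}+⋯+a_{r+2}, l = a_2 + h_1', k = a_1 + l + Σ h_i
    ΦCoef : (r j' : ℕ) → List ℕ → ℕ → Carrier
    ΦCoef r j' (a1 ∷ a2 ∷ rest) n =
      let hs = suffixSums rest
          l  = a2 + sumℕ rest
          k  = a1 + l + sumℕ hs
      in G r j' k l hs n
    ΦCoef r j' _ n = 0#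

    Φ : (r j' : ℕ) → Series (suc (suc r))
    Φ r j' α n = ΦCoef r j' (map α (allFin (suc (suc r)))) n

    -- A^{(j)}_i · Y  with j' = j+1 (so r-1-j = r ∸ j')
    AMul : (r j' i : ℕ) → Series (suc (suc r)) → Series (suc (suc r))
    AMul r j' i Y =
      ΣS (map (λ d → let m = i + d in
                 Sq q m i · (xmul (r + 2 ∸ m) Y ⊖ xmul 1 (xmul (r + 1 ∸ m) Y)))
              (upTo (suc (r ∸ j' ∸ i))))
      ⊕ (Sq q (r ∸ j') i · xmul 1 (xmul (j' + 1) Y))

    RHS : (r j' : ℕ) → Series (suc (suc r))
    RHS r j' = ΣS (map (λ i → AMul r j' i (zDi q i (Φ r r))) (upTo (suc (r ∸ j'))))

    δ : (r j' : ℕ) → Series (suc (suc r))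
    δ r zero = oneS
    δ r (suc _) = zeroS

module Submission where

-- The coefficient of x^β in Φ^t_j is a sum over all compositions of
--   the weight k(β) and depth l(β); an index kk passes the height filter exactly when its
--   own exponent vector  expOf kk  equals β.  So Φ^t_j is a filtered sum  Ser  over indices.
-- * First-part splitting.  Sorting indices by their first part gives, with H_v the series
--   of the Li^t_{(v,kk)} and Y the series of the indices with first part raised by one,
--       Φ_j = δ_{j,−1} + x_{j+3} H_{j+2} + Φ_{j+1}     and     Φ_{r−1} = x_{r+2} H_{r+1} + x_1 Y.
-- * q-derivative recurrence.  [n]·Li^t_{(a+1,kk)} = Li^t_{(a,kk)} on the z^n coefficient, so
--   H_v = [n] H_{v+1} and Φ_{r−1} = [n] Y; iterating, x_{r+2} H_{r−m} = [n]^{m+1} y₀ − [n]^m x_1 y₀.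
-- * Telescoping the first identity then yields, with R = r−1−j,
--       x_{r+2}(Φ_j − δ) = Σ_{m ≤ R} [n]^m x_{r+2−m} y₀ − Σ_{m < R} [n]^m x_1 x_{r+1−m} y₀.
-- * q-Stirling inversion.  z^i D_q^i multiplies z^n by the falling q-factorial
--   [n]_i = [n][n−1]⋯[n−i+1], and Σ_i S_q(m,i) [n]_i = [n]^m, which collapses the double sum
--   defining the right-hand side to the same expression.

open import Defs
open import Algebra.Bundles using (CommutativeRing)
open import Data.Nat using (ℕ; zero; suc; _+_; _∸_; _≤ᵇ_; _≡ᵇ_; _<ᵇ_; pred; _<_; _≤_; z≤n; s≤s; _<?_) renaming (_*_ to _*ℕ_)
import Data.Nat.Properties as ℕₚ
open import Data.Nat.Tactic.RingSolver using (solve-∀)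
open import Data.Bool using (Bool; true; false; if_then_else_; _∧_; T)
open import Data.Fin using (Fin; toℕ) renaming (zero to fz; suc to fs)
import Data.Fin.Properties as Finₚ
open import Data.Maybe using (just; nothing; maybe)
open import Data.List using (List; []; _∷_; map; _++_; concatMap; upTo; applyUpTo; length; allFin; zipWith)
import Data.List.Properties as Listₚ
open import Data.List.Relation.Unary.All using (All; []; _∷_)
import Data.List.Relation.Unary.All as All
open import Data.List.Relation.Unary.All.Properties using (concat⁺; map⁺; applyUpTo⁺₁)
open import Data.Product using (_×_; _,_; proj₁; proj₂; Σ)
open import Data.Sum using (_⊎_; inj₁; inj₂)
open import Data.Empty using (⊥-elim)
open import Function using (_∘_)
open import Relation.Binary.PropositionalEquality using (_≡_; _≢_; refl; sym; trans; cong; cong₂; subst)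
open import Relation.Binary.Definitions using (tri<; tri≈; tri>)
open import Relation.Nullary using (¬_; yes; no)

T⇒≡true : ∀ {b} → T b → b ≡ true
T⇒≡true {true} _ = refl

≡true⇒T : ∀ {b} → b ≡ true → T b
≡true⇒T refl = _

bool-ext : ∀ {a b : Bool} → (a ≡ true → b ≡ true) → (b ≡ true → a ≡ true) → a ≡ b
bool-ext {true} f g = sym (f refl)
bool-ext {false} {true} f g = g refl
bool-ext {false} {false} f g = refl

≡ᵇ-refl : ∀ p → (p ≡ᵇ p) ≡ true
≡ᵇ-refl p = T⇒≡true (ℕₚ.≡⇒≡ᵇ p p refl)

≡ᵇ-sound : ∀ p c → (p ≡ᵇ c) ≡ true → p ≡ c
≡ᵇ-sound p c h = ℕₚ.≡ᵇ⇒≡ p c (≡true⇒T h)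

≡ᵇ-false : ∀ p c → p ≢ c → (p ≡ᵇ c) ≡ false
≡ᵇ-false p c p≢c with p ≡ᵇ c in eq
... | true = ⊥-elim (p≢c (≡ᵇ-sound p c eq))
... | false = refl

≤ᵇ-false : ∀ m n → ¬ (m ≤ n) → (m ≤ᵇ n) ≡ false
≤ᵇ-false m n m≰n with m ≤ᵇ n in eq
... | true = ⊥-elim (m≰n (ℕₚ.≤ᵇ⇒≤ m n (≡true⇒T eq)))
... | false = refl

≡ᵇ-cancelˡ : ∀ a x y → (a + x ≡ᵇ a + y) ≡ (x ≡ᵇ y)
≡ᵇ-cancelˡ zero x y = refl
≡ᵇ-cancelˡ (suc a) x y = ≡ᵇ-cancelˡ a x y

applyUpTo-cong< : ∀ {A : Set} {f g : ℕ → A} n → (∀ i → i < n → f i ≡ g i) → applyUpTo f n ≡ applyUpTo g n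
applyUpTo-cong< zero h = refl
applyUpTo-cong< {f = f} {g} (suc n) h =
  cong₂ _∷_ (h 0 (s≤s z≤n)) (applyUpTo-cong< {f = f ∘ suc} {g ∘ suc} n (λ i i<n → h (suc i) (s≤s i<n)))

applyUpTo-injective : ∀ {A : Set} {f g : ℕ → A} n → applyUpTo f n ≡ applyUpTo g n → ∀ i → i < n → f i ≡ g i
applyUpTo-injective (suc n) eq zero _ = Listₚ.∷-injectiveˡ eq
applyUpTo-injective {f = f} {g} (suc n) eq (suc i) (s≤s i<n) =
  applyUpTo-injective {f = f ∘ suc} {g ∘ suc} n (Listₚ.∷-injectiveʳ eq) i i<n

applyUpTo-zipWith : ∀ n (f g : ℕ → ℕ) → zipWith _+_ (applyUpTo f n) (applyUpTo g n) ≡ applyUpTo (λ i → f i + g i) n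
applyUpTo-zipWith zero f g = refl
applyUpTo-zipWith (suc n) f g = cong (f 0 + g 0 ∷_) (applyUpTo-zipWith n (f ∘ suc) (g ∘ suc))

sumℕ-zeros : ∀ n → sumℕ (applyUpTo (λ _ → 0) n) ≡ 0
sumℕ-zeros zero = refl
sumℕ-zeros (suc n) = sumℕ-zeros n

kron : ℕ → ℕ → ℕ
kron zero zero = 1
kron zero (suc i) = 0
kron (suc c) zero = 0
kron (suc c) (suc i) = kron c i

kron-diag : ∀ b → kron b b ≡ 1
kron-diag zero = refl
kron-diag (suc b) = kron-diag b

kron-off : ∀ b i → i ≢ b → kron b i ≡ 0
kron-off zero zero h = ⊥-elim (h refl)
kron-off zero (suc i) h = refl
kron-off (suc b) zero h = refl
kron-off (suc b) (suc i) h = kron-off b i (λ e → h (cong suc e))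

atMost : ℕ → ℕ → ℕ
atMost zero c = 1
atMost (suc i) zero = 0
atMost (suc i) (suc c) = atMost i c

atMost-test : ∀ i c → atMost i c ≡ (if i <ᵇ suc c then 1 else 0)
atMost-test zero c = refl
atMost-test (suc i) zero = refl
atMost-test (suc i) (suc c) = atMost-test i c

atMost-< : ∀ i c → i < suc c → atMost i c ≡ 1
atMost-< zero c _ = refl
atMost-< (suc i) (suc c) (s≤s h) = atMost-< i c h

sum-atMost : ∀ n c → c < n → sumℕ (applyUpTo (λ i → atMost i c) n) ≡ suc c
sum-atMost (suc n) zero _ = cong suc (sumℕ-zeros n)
sum-atMost (suc n) (suc c) (s≤s c<n) = cong suc (sum-atMost n c c<n)

-- Suffix sums (a₁+⋯+a_m, a₂+⋯+a_m, …, a_m): the heights h_i as functions of the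
-- exponents of x_3,…,x_{r+2}.  The map is injective.
sufSums : List ℕ → List ℕ
sufSums [] = []
sufSums (a ∷ as) = (a + sumℕ as) ∷ sufSums as

sufSums-injective : ∀ xs ys → sufSums xs ≡ sufSums ys → xs ≡ ys
sufSums-injective [] [] _ = refl
sufSums-injective (x ∷ xs) (y ∷ ys) eq with sufSums-injective xs ys (Listₚ.∷-injectiveʳ eq)
... | refl = cong (_∷ xs) (ℕₚ.+-cancelʳ-≡ (sumℕ xs) x y (Listₚ.∷-injectiveˡ eq))

sufSums-zeros : ∀ n → sufSums (applyUpTo (λ _ → 0) n) ≡ applyUpTo (λ _ → 0) n
sufSums-zeros zero = refl
sufSums-zeros (suc n) = cong₂ _∷_ (sumℕ-zeros n) (sufSums-zeros n)

sum-addKron : ∀ n c (g : ℕ → ℕ) → c < n → sumℕ (applyUpTo (λ i → kron c i + g i) n) ≡ suc (sumℕ (applyUpTo g n))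
sum-addKron (suc n) zero g _ = refl
sum-addKron (suc n) (suc c) g (s≤s c<n) = trans (cong (g 0 +_) (sum-addKron n c (g ∘ suc) c<n)) (ℕₚ.+-suc (g 0) _)

zipWith-zeros : ∀ n (h : ℕ → ℕ) → zipWith _+_ (applyUpTo (λ _ → 0) n) (sufSums (applyUpTo h n)) ≡ sufSums (applyUpTo h n)
zipWith-zeros zero h = refl
zipWith-zeros (suc n) h = cong (h 0 + sumℕ (applyUpTo (h ∘ suc) n) ∷_) (zipWith-zeros n (h ∘ suc))

sufSums-addKron : ∀ n c (g : ℕ → ℕ) → c < n →
  sufSums (applyUpTo (λ i → kron c i + g i) n) ≡ zipWith _+_ (applyUpTo (λ i → atMost i c) n) (sufSums (applyUpTo g n))
sufSums-addKron (suc n) zero g _ = cong (suc (g 0 + sumℕ (applyUpTo (g ∘ suc) n)) ∷_) (sym (zipWith-zeros n (g ∘ suc)))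
sufSums-addKron (suc n) (suc c) g (s≤s c<n) =
  cong₂ _∷_ (trans (cong (g 0 +_) (sum-addKron n c (g ∘ suc) c<n)) (ℕₚ.+-suc (g 0) _)) (sufSums-addKron n c (g ∘ suc) c<n)

sum-zipWith-sufSums : ∀ n (f h : ℕ → ℕ) →
  sumℕ (zipWith _+_ (applyUpTo f n) (sufSums (applyUpTo h n))) ≡ sumℕ (applyUpTo f n) + sumℕ (sufSums (applyUpTo h n))
sum-zipWith-sufSums zero f h = refl
sum-zipWith-sufSums (suc n) f h =
  trans (cong (f 0 + b +_) (sum-zipWith-sufSums n (f ∘ suc) (h ∘ suc))) (swap (f 0) b X Y)
  where
  b = h 0 + sumℕ (applyUpTo (h ∘ suc) n)
  X = sumℕ (applyUpTo (f ∘ suc) n)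
  Y = sumℕ (sufSums (applyUpTo (h ∘ suc) n))
  swap : ∀ a b x y → a + b + (x + y) ≡ a + x + (b + y)
  swap = solve-∀

agreeOn : ℕ → (ℕ → ℕ) → (ℕ → ℕ) → Bool
agreeOn zero β γ = true
agreeOn (suc n) β γ = (β 0 ≡ᵇ γ 0) ∧ agreeOn n (β ∘ suc) (γ ∘ suc)

agreeOn-sound : ∀ n β γ → agreeOn n β γ ≡ true → ∀ i → i < n → β i ≡ γ i
agreeOn-sound (suc n) β γ h i i<n with β 0 ≡ᵇ γ 0 in eq
agreeOn-sound (suc n) β γ h zero i<n | true = ≡ᵇ-sound (β 0) (γ 0) eq
agreeOn-sound (suc n) β γ h (suc i) (s≤s i<n) | true = agreeOn-sound n (β ∘ suc) (γ ∘ suc) h i i<n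

agreeOn-complete : ∀ n β γ → (∀ i → i < n → β i ≡ γ i) → agreeOn n β γ ≡ true
agreeOn-complete zero β γ h = refl
agreeOn-complete (suc n) β γ h rewrite T⇒≡true (ℕₚ.≡⇒≡ᵇ (β 0) (γ 0) (h 0 (s≤s z≤n))) =
  agreeOn-complete n (β ∘ suc) (γ ∘ suc) (λ i i<n → h (suc i) (s≤s i<n))

agreeOn-cong : ∀ n {δ δ' β β' : ℕ → ℕ} → (∀ i → δ i ≡ δ' i) → (∀ i → β i ≡ β' i) → agreeOn n δ β ≡ agreeOn n δ' β'
agreeOn-cong zero h1 h2 = refl
agreeOn-cong (suc n) h1 h2 = cong₂ _∧_ (cong₂ _≡ᵇ_ (h1 0) (h2 0)) (agreeOn-cong n (h1 ∘ suc) (h2 ∘ suc))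

agreeOn-shift : ∀ n (u : ℕ → ℕ) {δ ε β γ : ℕ → ℕ} → (∀ i → δ i ≡ u i + ε i) → (∀ i → β i ≡ u i + γ i) →
  agreeOn n δ β ≡ agreeOn n ε γ
agreeOn-shift zero u h1 h2 = refl
agreeOn-shift (suc n) u {ε = ε} {γ = γ} h1 h2 =
  cong₂ _∧_ (trans (cong₂ _≡ᵇ_ (h1 0) (h2 0)) (≡ᵇ-cancelˡ (u 0) (ε 0) (γ 0))) (agreeOn-shift n (u ∘ suc) (h1 ∘ suc) (h2 ∘ suc))

agreeOn-zero : ∀ n (β : ℕ → ℕ) → agreeOn n (λ _ → 0) β ≡ (sumℕ (applyUpTo β n) ≡ᵇ 0)
agreeOn-zero zero β = refl
agreeOn-zero (suc n) β with β 0
... | zero = agreeOn-zero n (β ∘ suc)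
... | suc _ = refl

eqList-sound : ∀ xs ys → eqList xs ys ≡ true → xs ≡ ys
eqList-sound [] [] _ = refl
eqList-sound (x ∷ xs) (y ∷ ys) h with x ≡ᵇ y in eq
... | true = cong₂ _∷_ (≡ᵇ-sound x y eq) (eqList-sound xs ys h)

eqList-refl : ∀ xs → eqList xs xs ≡ true
eqList-refl [] = refl
eqList-refl (x ∷ xs) rewrite ≡ᵇ-refl x = eqList-refl xs

IsIndex : ℕ → ℕ → List ℕ → Set
IsIndex k l kk = All (1 ≤_) kk × sumℕ kk ≡ k × length kk ≡ l

comps-suc : ∀ k l → comps k (suc l) ≡ concatMap (λ p → map (suc p ∷_) (comps (k ∸ suc p) l)) (upTo k)
comps-suc zero l = refl
comps-suc (suc k) l = refl

comps-IsIndex : ∀ k l → All (IsIndex k l) (comps k l)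
comps-IsIndex zero zero = ([] , refl , refl) ∷ []
comps-IsIndex (suc k) zero = []
comps-IsIndex k (suc l) rewrite comps-suc k l =
  concat⁺ (map⁺ (applyUpTo⁺₁ _ k (λ {p} p<k →
    map⁺ (All.map (λ (pos , s , len) → (s≤s z≤n ∷ pos) , trans (cong (suc p +_) s) (ℕₚ.m+[n∸m]≡n p<k) , cong suc len)
                  (comps-IsIndex (k ∸ suc p) l)))))

-- A monomial x^β (β i is the exponent of x_{i+1},
-- i < N = r+2) determines the weight, depth and heights of the indices contributing to it;
-- conversely each index kk has an exponent vector  expOf kk, the sum of the vectors of its
-- parts.
module ExponentCode (r' : ℕ) where
  r N : ℕ
  r = suc r'
  N = suc (suc r)

  restOf : (ℕ → ℕ) → List ℕ
  restOf β = applyUpTo (λ i → β (suc (suc i))) r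

  heightsOf : (ℕ → ℕ) → List ℕ
  heightsOf β = sufSums (restOf β)

  depthOf : (ℕ → ℕ) → ℕ
  depthOf β = β 1 + sumℕ (restOf β)

  weightOf : (ℕ → ℕ) → ℕ
  weightOf β = β 0 + depthOf β + sumℕ (heightsOf β)

  -- A part v ≤ r+1 contributes x_{v+1}; a larger part contributes x_{r+2} x_1^{v−r−1}.
  partExp : ℕ → ℕ → ℕ
  partExp v i = if v ≤ᵇ suc r then kron v i else kron (suc r) i + kron 0 i *ℕ (v ∸ suc r)

  expOf : List ℕ → ℕ → ℕ
  expOf [] i = 0
  expOf (v ∷ kk) i = partExp v i + expOf kk i

  heights' : List ℕ → List ℕ
  heights' kk = applyUpTo (λ i → count (suc i) kk) r

  heights≡heights' : ∀ kk → heights r kk ≡ heights' kk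
  heights≡heights' kk = Listₚ.map-upTo (λ i → count (suc i) kk) r

  record Shifted (β γ : ℕ → ℕ) (dk dl : ℕ) (dh : List ℕ → List ℕ) : Set where
    field
      weight≡ : weightOf β ≡ dk + weightOf γ
      depth≡ : depthOf β ≡ dl + depthOf γ
      heights≡ : heightsOf β ≡ dh (heightsOf γ)
  open Shifted public

  rest-cong : ∀ {β γ} → (∀ i → i < N → β i ≡ γ i) → restOf β ≡ restOf γ
  rest-cong h = applyUpTo-cong< r (λ i i<r → h (suc (suc i)) (s≤s (s≤s i<r)))

  shift-cong : ∀ {β γ} → (∀ i → i < N → β i ≡ γ i) → Shifted β γ 0 0 (λ hs → hs)
  shift-cong {β} {γ} h = record { weight≡ = wEq ; depth≡ = dEq ; heights≡ = cong sufSums (rest-cong h) }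
    where
    dEq : depthOf β ≡ depthOf γ
    dEq = cong₂ (λ a b → a + sumℕ b) (h 1 (s≤s (s≤s z≤n))) (rest-cong h)
    wEq : weightOf β ≡ weightOf γ
    wEq = cong₂ (λ a b → a + sumℕ (sufSums b)) (cong₂ _+_ (h 0 (s≤s z≤n)) dEq) (rest-cong h)

  shift-x1 : ∀ {β γ} s → (∀ i → β i ≡ kron 0 i *ℕ s + γ i) → Shifted β γ s 0 (λ hs → hs)
  shift-x1 {β} {γ} s h = record { weight≡ = wEq ; depth≡ = dEq ; heights≡ = cong sufSums rEq }
    where
    rEq : restOf β ≡ restOf γ
    rEq = applyUpTo-cong< r (λ i _ → h (suc (suc i)))
    dEq : depthOf β ≡ depthOf γ
    dEq = cong₂ (λ a b → a + sumℕ b) (h 1) rEq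
    assoc : ∀ s a d h → 1 *ℕ s + a + d + h ≡ s + (a + d + h)
    assoc = solve-∀
    wEq : weightOf β ≡ s + weightOf γ
    wEq = trans (cong₂ (λ a b → a + sumℕ (sufSums b)) (cong₂ _+_ (h 0) dEq) rEq) (assoc s (γ 0) (depthOf γ) _)

  shift-part1 : ∀ {β γ} → (∀ i → β i ≡ kron 1 i + γ i) → Shifted β γ 1 1 (λ hs → hs)
  shift-part1 {β} {γ} h = record { weight≡ = wEq ; depth≡ = dEq ; heights≡ = cong sufSums rEq }
    where
    rEq : restOf β ≡ restOf γ
    rEq = applyUpTo-cong< r (λ i _ → h (suc (suc i)))
    dEq : depthOf β ≡ suc (depthOf γ)
    dEq = cong₂ (λ a b → a + sumℕ b) (h 1) rEq
    wEq : weightOf β ≡ suc (weightOf γ)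
    wEq = trans (cong₂ (λ a b → a + sumℕ (sufSums b)) (cong₂ _+_ (h 0) dEq) rEq)
                (cong (_+ sumℕ (heightsOf γ)) (ℕₚ.+-suc (γ 0) (depthOf γ)))

  shift-part : ∀ {β γ} c → c < r → (∀ i → β i ≡ kron (suc (suc c)) i + γ i) →
    Shifted β γ (suc (suc c)) 1 (zipWith _+_ (applyUpTo (λ i → atMost i c) r))
  shift-part {β} {γ} c c<r h = record { weight≡ = wEq ; depth≡ = dEq ; heights≡ = hEq }
    where
    g = λ i → γ (suc (suc i))
    rEq : restOf β ≡ applyUpTo (λ i → kron c i + g i) r
    rEq = applyUpTo-cong< r (λ i _ → h (suc (suc i)))
    dEq : depthOf β ≡ suc (depthOf γ)
    dEq = trans (cong₂ (λ a b → a + sumℕ b) (h 1) rEq)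
                (trans (cong (γ 1 +_) (sum-addKron r c g c<r)) (ℕₚ.+-suc (γ 1) _))
    hEq : heightsOf β ≡ zipWith _+_ (applyUpTo (λ i → atMost i c) r) (heightsOf γ)
    hEq = trans (cong sufSums rEq) (sufSums-addKron r c g c<r)
    sEq : sumℕ (heightsOf β) ≡ suc c + sumℕ (heightsOf γ)
    sEq = trans (cong sumℕ hEq) (trans (sum-zipWith-sufSums r (λ i → atMost i c) g)
                                       (cong (_+ sumℕ (heightsOf γ)) (sum-atMost r c c<r)))
    arith : ∀ a l c s → a + suc l + (suc c + s) ≡ suc (suc c) + (a + l + s)
    arith = solve-∀
    wEq : weightOf β ≡ suc (suc c) + weightOf γ
    wEq = trans (cong₂ (λ a b → a + b + sumℕ (heightsOf β)) (h 0) dEq)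
                (trans (cong (γ 0 + suc (depthOf γ) +_) sEq) (arith (γ 0) (depthOf γ) c (sumℕ (heightsOf γ))))

  decode-injective : ∀ {β γ} → weightOf β ≡ weightOf γ → depthOf β ≡ depthOf γ → heightsOf β ≡ heightsOf γ →
    ∀ i → i < N → β i ≡ γ i
  decode-injective {β} {γ} hw hd hh = coord
    where
    rEq : restOf β ≡ restOf γ
    rEq = sufSums-injective _ _ hh
    β1 : β 1 ≡ γ 1
    β1 = ℕₚ.+-cancelʳ-≡ (sumℕ (restOf γ)) (β 1) (γ 1) (trans (cong (λ x → β 1 + sumℕ x) (sym rEq)) hd)
    β0 : β 0 ≡ γ 0
    β0 = ℕₚ.+-cancelʳ-≡ (depthOf γ) (β 0) (γ 0) (ℕₚ.+-cancelʳ-≡ (sumℕ (heightsOf γ)) (β 0 + depthOf γ) (γ 0 + depthOf γ)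
           (trans (cong₂ (λ a b → β 0 + a + sumℕ b) (sym hd) (sym hh)) hw))
    coord : ∀ i → i < N → β i ≡ γ i
    coord zero _ = β0
    coord (suc zero) _ = β1
    coord (suc (suc i)) (s≤s (s≤s i<r)) = applyUpTo-injective {f = λ i → β (suc (suc i))} {g = λ i → γ (suc (suc i))} r rEq i i<r

  partExp-unit : ∀ v → v ≤ suc r → ∀ i → partExp v i ≡ kron v i
  partExp-unit v v≤ i rewrite T⇒≡true (ℕₚ.≤⇒≤ᵇ v≤) = refl

  partExp-big : ∀ c → r ≤ c → ∀ i → partExp (suc (suc c)) i ≡ kron (suc r) i + kron 0 i *ℕ (suc (suc c) ∸ suc r)
  partExp-big c r≤c i rewrite ≤ᵇ-false (suc (suc c)) (suc r) (λ h → ℕₚ.<⇒≱ (ℕₚ.≤-pred h) r≤c) = refl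

  record Decodes (kk : List ℕ) : Set where
    field
      weight-expOf : weightOf (expOf kk) ≡ sumℕ kk
      depth-expOf : depthOf (expOf kk) ≡ length kk
      heights-expOf : heightsOf (expOf kk) ≡ heights' kk
  open Decodes public

  decodes-∷ : ∀ v kk {dh : List ℕ → List ℕ} → Decodes kk →
    Shifted (expOf (v ∷ kk)) (expOf kk) v 1 dh →
    dh (heights' kk) ≡ heights' (v ∷ kk) → Decodes (v ∷ kk)
  decodes-∷ v kk {dh} d s hs = record
    { weight-expOf = trans (weight≡ s) (cong (v +_) (weight-expOf d))
    ; depth-expOf = trans (depth≡ s) (cong suc (depth-expOf d))
    ; heights-expOf = trans (heights≡ s) (trans (cong dh (heights-expOf d)) hs) }

  heights'-addAtMost : ∀ c v kk → (∀ i → i < r → atMost i c ≡ (if suc (suc i) ≤ᵇ v then 1 else 0)) →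
    zipWith _+_ (applyUpTo (λ i → atMost i c) r) (heights' kk) ≡ heights' (v ∷ kk)
  heights'-addAtMost c v kk h = trans (applyUpTo-zipWith r (λ i → atMost i c) (λ i → count (suc i) kk))
                                     (applyUpTo-cong< r (λ i i<r → cong (_+ count (suc i) kk) (h i i<r)))

  expOf-decodes : ∀ kk → All (1 ≤_) kk → Decodes kk
  expOf-decodes [] _ = record { weight-expOf = trans (cong₂ (λ a b → a + sumℕ b) (sumℕ-zeros r) (sufSums-zeros r)) (sumℕ-zeros r)
                              ; depth-expOf = sumℕ-zeros r ; heights-expOf = sufSums-zeros r }
  expOf-decodes (suc zero ∷ kk) (_ ∷ pos) = decodes-∷ 1 kk (expOf-decodes kk pos) (shift-part1 (λ i → refl)) refl
  expOf-decodes (suc (suc c) ∷ kk) (_ ∷ pos) with c <? r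
  ... | yes c<r = decodes-∷ (suc (suc c)) kk (expOf-decodes kk pos)
                    (shift-part c c<r (λ i → cong (_+ expOf kk i) (partExp-unit (suc (suc c)) (s≤s c<r) i)))
                    (heights'-addAtMost c (suc (suc c)) kk (λ i _ → atMost-test i c))
  ... | no c≮r = decodes-∷ (suc (suc c)) kk (expOf-decodes kk pos) shifted
                   (heights'-addAtMost r' (suc (suc c)) kk (λ i i<r → trans (atMost-< i r' i<r)
                      (sym (cong (λ b → if b then 1 else 0) (T⇒≡true (ℕₚ.≤⇒≤ᵇ (ℕₚ.m≤n⇒m≤1+n (ℕₚ.≤-trans i<r r≤c))))))))
    where
    r≤c : r ≤ c
    r≤c = ℕₚ.≮⇒≥ c≮r
    s = suc (suc c) ∸ suc r
    -- a big part is x_1^s times the part r+1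
    mid : ℕ → ℕ
    mid i = kron (suc r) i + expOf kk i
    viaX1 : Shifted (expOf (suc (suc c) ∷ kk)) mid s 0 (λ hs → hs)
    viaX1 = shift-x1 s (λ i → trans (cong (_+ expOf kk i) (partExp-big c r≤c i))
              (trans (cong (_+ expOf kk i) (ℕₚ.+-comm (kron (suc r) i) _)) (ℕₚ.+-assoc _ (kron (suc r) i) (expOf kk i))))
    viaTop : Shifted mid (expOf kk) (suc r) 1 (zipWith _+_ (applyUpTo (λ i → atMost i r') r))
    viaTop = shift-part r' (ℕₚ.n<1+n r') (λ i → refl)
    shifted : Shifted (expOf (suc (suc c) ∷ kk)) (expOf kk) (suc (suc c)) 1 (zipWith _+_ (applyUpTo (λ i → atMost i r') r))
    shifted = record
      { weight≡ = trans (weight≡ viaX1) (trans (cong (s +_) (weight≡ viaTop))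
                  (trans (sym (ℕₚ.+-assoc s (suc r) _)) (cong (_+ weightOf (expOf kk)) (ℕₚ.m∸n+n≡m {suc (suc c)} {suc r} (s≤s (ℕₚ.m≤n⇒m≤1+n r≤c))))))
      ; depth≡ = trans (depth≡ viaX1) (depth≡ viaTop)
      ; heights≡ = trans (heights≡ viaX1) (heights≡ viaTop) }

  heightTest≡agree : ∀ β kk → IsIndex (weightOf β) (depthOf β) kk → eqList (heights r kk) (heightsOf β) ≡ agreeOn N (expOf kk) β
  heightTest≡agree β kk (pos , w , len) = bool-ext to from
    where
    d = expOf-decodes kk pos
    to : eqList (heights r kk) (heightsOf β) ≡ true → agreeOn N (expOf kk) β ≡ true
    to h = agreeOn-complete N (expOf kk) β (decode-injective (trans (weight-expOf d) w) (trans (depth-expOf d) len)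
             (trans (heights-expOf d) (trans (sym (heights≡heights' kk)) (eqList-sound _ _ h))))
    from : agreeOn N (expOf kk) β ≡ true → eqList (heights r kk) (heightsOf β) ≡ true
    from h = subst (λ x → eqList (heights r kk) x ≡ true)
               (trans (heights≡heights' kk) (trans (sym (heights-expOf d)) (heights≡ (shift-cong (agreeOn-sound N (expOf kk) β h)))))
               (eqList-refl (heights r kk))

toℕFun : ∀ {N} → (Fin N → ℕ) → ℕ → ℕ
toℕFun {N} α i = maybe α 0 (toFin? N i)

toℕFun-suc : ∀ {N} (α : Fin (suc N) → ℕ) i → toℕFun α (suc i) ≡ toℕFun (α ∘ fs) i
toℕFun-suc {N} α i with toFin? N i
... | just p = refl
... | nothing = refl

toℕFun-cong : ∀ {N} (α α' : Fin N → ℕ) → (∀ i → α i ≡ α' i) → ∀ i → toℕFun α i ≡ toℕFun α' i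
toℕFun-cong {N} α α' h i with toFin? N i
... | nothing = refl
... | just p = h p

map-allFin≡applyUpTo : ∀ N (α : Fin N → ℕ) → map α (allFin N) ≡ applyUpTo (toℕFun α) N
map-allFin≡applyUpTo zero α = refl
map-allFin≡applyUpTo (suc N) α =
  cong (α fz ∷_) (trans (trans (Listₚ.map-tabulate fs α) (sym (Listₚ.map-tabulate (λ i → i) (α ∘ fs))))
                        (trans (map-allFin≡applyUpTo N (α ∘ fs)) (applyUpTo-cong< N (λ i _ → sym (toℕFun-suc α i)))))

toFin?-toℕ : ∀ N i p → toFin? N i ≡ just p → toℕ p ≡ i
toFin?-toℕ (suc N) zero fz refl = refl
toFin?-toℕ (suc N) (suc i) p eq with toFin? N i in e2
toFin?-toℕ (suc N) (suc i) .(fs p') refl | just p' = cong suc (toFin?-toℕ N i p' e2)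

toFin?-just : ∀ N i → i < N → Σ (Fin N) (λ p → toFin? N i ≡ just p)
toFin?-just (suc N) zero _ = fz , refl
toFin?-just (suc N) (suc i) (s≤s i<N) with toFin? N i | toFin?-just N i i<N
... | .(just p) | p , refl = fs p , refl

lowerAt : ∀ {N} → Fin N → (Fin N → ℕ) → Fin N → ℕ
lowerAt p α i = if toℕ i ≡ᵇ toℕ p then pred (α i) else α i

lowerAt-comm : ∀ {N} (p p' : Fin N) α → toℕ p ≢ toℕ p' → ∀ i → lowerAt p' (lowerAt p α) i ≡ lowerAt p (lowerAt p' α) i
lowerAt-comm p p' α ne i with toℕ i ≡ᵇ toℕ p in e1 | toℕ i ≡ᵇ toℕ p' in e2
... | true | true = ⊥-elim (ne (trans (sym (≡ᵇ-sound (toℕ i) (toℕ p) e1)) (≡ᵇ-sound (toℕ i) (toℕ p') e2)))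
... | true | false = refl
... | false | true = refl
... | false | false = refl

lowerAt-other : ∀ {N} (p p' : Fin N) α → toℕ p ≢ toℕ p' → lowerAt p α p' ≡ α p'
lowerAt-other p p' α ne rewrite ≡ᵇ-false (toℕ p') (toℕ p) (λ e → ne (sym e)) = refl

lowerℕ : ℕ → (ℕ → ℕ) → ℕ → ℕ
lowerℕ b β i = if i ≡ᵇ b then pred (β i) else β i

lowerℕ-split : ∀ b (β : ℕ → ℕ) c → β b ≡ suc c → ∀ i → β i ≡ kron b i + lowerℕ b β i
lowerℕ-split b β c h i with i ≡ᵇ b in eq
... | true rewrite ≡ᵇ-sound i b eq | kron-diag b | h = refl
... | false = sym (cong (_+ β i) (kron-off b i i≢b))
  where
  i≢b : i ≢ b
  i≢b refl with () ← trans (sym (≡ᵇ-refl i)) eq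

toℕFun-lowerAt : ∀ {N} b p (α : Fin N → ℕ) → toFin? N b ≡ just p → ∀ i → toℕFun (lowerAt p α) i ≡ lowerℕ b (toℕFun α) i
toℕFun-lowerAt {N} b p α eq i = byPosition (toFin? N i) refl
  where
  pred0 : ∀ (c : Bool) → (if c then pred 0 else 0) ≡ 0
  pred0 true = refl
  pred0 false = refl
  byPosition : ∀ m → toFin? N i ≡ m → toℕFun (lowerAt p α) i ≡ lowerℕ b (toℕFun α) i
  byPosition nothing e2 = trans (cong (maybe (lowerAt p α) 0) e2)
                            (sym (trans (cong (λ x → if i ≡ᵇ b then pred x else x) (cong (maybe α 0) e2)) (pred0 (i ≡ᵇ b))))
  byPosition (just p') e2 = trans (cong (maybe (lowerAt p α) 0) e2)
                              (trans (cong₂ (λ x y → if x ≡ᵇ y then pred (α p') else α p') (toFin?-toℕ N i p' e2) (toFin?-toℕ N b p eq))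
                                     (sym (cong (λ x → if i ≡ᵇ b then pred x else x) (cong (maybe α 0) e2))))

headIs : ℕ → List ℕ → Bool
headIs v [] = false
headIs v (k ∷ _) = k ≡ᵇ v

isEmptyAt : ℕ → List ℕ → Bool
isEmptyAt j' [] = j' ≡ᵇ 0
isEmptyAt j' (_ ∷ _) = false

raise : List ℕ → List ℕ
raise [] = []
raise (k ∷ kk) = suc k ∷ kk

module RingSums {c ℓ} (R : CommutativeRing c ℓ) where
  open CommutativeRing R renaming (_+_ to _⊞_; refl to ≈refl; sym to ≈sym; trans to ≈trans)
  open Q R
  open import Algebra.Solver.Ring.NaturalCoefficients.Default commutativeSemiring public
  open import Algebra.Properties.AbelianGroup +-abelianGroup using (⁻¹-∙-comm; xyx⁻¹≈y)
  open import Algebra.Properties.Group +-group using (ε⁻¹≈ε)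
  open import Algebra.Properties.Ring ring public using (x[y-z]≈xy-xz)

  ≡→≈ : ∀ {x y} → x ≡ y → x ≈ y
  ≡→≈ refl = ≈refl

  sumR-++ : ∀ xs ys → sumR (xs ++ ys) ≈ sumR xs ⊞ sumR ys
  sumR-++ [] ys = ≈sym (+-identityˡ _)
  sumR-++ (x ∷ xs) ys = ≈trans (+-congˡ (sumR-++ xs ys)) (≈sym (+-assoc x _ _))

  sumR-congAll : ∀ {a p} {A : Set a} {Pr : A → Set p} (f g : A → Carrier) {xs} → All Pr xs →
    (∀ x → Pr x → f x ≈ g x) → sumR (map f xs) ≈ sumR (map g xs)
  sumR-congAll f g [] h = ≈refl
  sumR-congAll f g (px ∷ pxs) h = +-cong (h _ px) (sumR-congAll f g pxs h)

  sumR-cong : ∀ {a} {A : Set a} (f g : A → Carrier) xs → (∀ x → f x ≈ g x) → sumR (map f xs) ≈ sumR (map g xs)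
  sumR-cong f g [] h = ≈refl
  sumR-cong f g (x ∷ xs) h = +-cong (h x) (sumR-cong f g xs h)

  sumR-zero : ∀ {a} {A : Set a} (f : A → Carrier) xs → (∀ x → f x ≈ 0#) → sumR (map f xs) ≈ 0#
  sumR-zero f [] h = ≈refl
  sumR-zero f (x ∷ xs) h = ≈trans (+-cong (h x) (sumR-zero f xs h)) (+-identityˡ 0#)

  interchange : ∀ a b c d → a ⊞ b ⊞ (c ⊞ d) ≈ a ⊞ c ⊞ (b ⊞ d)
  interchange = solve 4 (λ a b c d → a :+ b :+ (c :+ d) := a :+ c :+ (b :+ d)) ≈refl

  sumR-+ : ∀ {a} {A : Set a} (f g : A → Carrier) xs → sumR (map (λ x → f x ⊞ g x) xs) ≈ sumR (map f xs) ⊞ sumR (map g xs)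
  sumR-+ f g [] = ≈sym (+-identityˡ 0#)
  sumR-+ f g (x ∷ xs) = ≈trans (+-congˡ (sumR-+ f g xs)) (interchange (f x) (g x) _ _)

  sumR-* : ∀ {a} {A : Set a} (k : Carrier) (f : A → Carrier) xs → sumR (map (λ x → k * f x) xs) ≈ k * sumR (map f xs)
  sumR-* k f [] = ≈sym (zeroʳ k)
  sumR-* k f (x ∷ xs) = ≈trans (+-congˡ (sumR-* k f xs)) (≈sym (distribˡ k (f x) _))

  sumR-concatMap : ∀ {a b} {A : Set a} {B : Set b} (f : B → Carrier) (g : A → List B) xs →
    sumR (map f (concatMap g xs)) ≈ sumR (map (λ x → sumR (map f (g x))) xs)
  sumR-concatMap f g [] = ≈refl
  sumR-concatMap f g (x ∷ xs) =
    ≈trans (≡→≈ (cong sumR (Listₚ.map-++ f (g x) (concatMap g xs))))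
           (≈trans (sumR-++ (map f (g x)) _) (+-congˡ (sumR-concatMap f g xs)))

  sumR-map-map : ∀ {a b} {A : Set a} {B : Set b} (f : B → Carrier) (g : A → B) xs →
    sumR (map f (map g xs)) ≡ sumR (map (f ∘ g) xs)
  sumR-map-map f g xs = cong sumR (sym (Listₚ.map-∘ xs))

  Σ< : ℕ → (ℕ → Carrier) → Carrier
  Σ< n F = sumR (applyUpTo F n)

  sumR-upTo : ∀ n (F : ℕ → Carrier) → sumR (map F (upTo n)) ≡ Σ< n F
  sumR-upTo n F = cong sumR (Listₚ.map-upTo F n)

  Σ<-cong : ∀ n {F G : ℕ → Carrier} → (∀ i → i < n → F i ≈ G i) → Σ< n F ≈ Σ< n G
  Σ<-cong zero h = ≈refl
  Σ<-cong (suc n) {F} {G} h = +-cong (h 0 (s≤s z≤n)) (Σ<-cong n {F ∘ suc} {G ∘ suc} (λ i i<n → h (suc i) (s≤s i<n)))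

  Σ<-zero : ∀ n (F : ℕ → Carrier) → (∀ i → i < n → F i ≈ 0#) → Σ< n F ≈ 0#
  Σ<-zero zero F h = ≈refl
  Σ<-zero (suc n) F h = ≈trans (+-cong (h 0 (s≤s z≤n)) (Σ<-zero n (F ∘ suc) (λ i i<n → h (suc i) (s≤s i<n)))) (+-identityˡ 0#)

  Σ<-single : ∀ n c (F : ℕ → Carrier) → c < n → (∀ p → p ≢ c → F p ≈ 0#) → Σ< n F ≈ F c
  Σ<-single (suc n) zero F _ h = ≈trans (+-congˡ (Σ<-zero n (F ∘ suc) (λ i _ → h (suc i) (λ ())))) (+-identityʳ _)
  Σ<-single (suc n) (suc c) F (s≤s c<n) h =
    ≈trans (+-cong (h 0 (λ ())) (Σ<-single n c (F ∘ suc) c<n (λ p p≢c → h (suc p) (λ e → p≢c (cong pred e)))))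
           (+-identityˡ _)

  Σ<-+ : ∀ n (F G : ℕ → Carrier) → Σ< n (λ i → F i ⊞ G i) ≈ Σ< n F ⊞ Σ< n G
  Σ<-+ zero F G = ≈sym (+-identityˡ 0#)
  Σ<-+ (suc n) F G = ≈trans (+-congˡ (Σ<-+ n (F ∘ suc) (G ∘ suc))) (interchange (F 0) (G 0) _ _)

  Σ<-* : ∀ n k (F : ℕ → Carrier) → Σ< n (λ i → k * F i) ≈ k * Σ< n F
  Σ<-* zero k F = ≈sym (zeroʳ k)
  Σ<-* (suc n) k F = ≈trans (+-congˡ (Σ<-* n k (F ∘ suc))) (≈sym (distribˡ k (F 0) _))

  Σ<-*ʳ : ∀ n k (F : ℕ → Carrier) → Σ< n (λ i → F i * k) ≈ Σ< n F * k
  Σ<-*ʳ n k F = ≈trans (Σ<-cong n (λ i _ → *-comm (F i) k)) (≈trans (Σ<-* n k F) (*-comm k _))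

  Σ<-neg : ∀ n (F : ℕ → Carrier) → Σ< n (λ i → - F i) ≈ - Σ< n F
  Σ<-neg zero F = ≈sym ε⁻¹≈ε
  Σ<-neg (suc n) F = ≈trans (+-congˡ (Σ<-neg n (F ∘ suc))) (⁻¹-∙-comm (F 0) _)

  Σ<-- : ∀ n (F G : ℕ → Carrier) → Σ< n (λ i → F i - G i) ≈ Σ< n F - Σ< n G
  Σ<-- n F G = ≈trans (Σ<-+ n F (λ i → - G i)) (+-congˡ (Σ<-neg n G))

  Σ<-split : ∀ a b (F : ℕ → Carrier) → Σ< (a + b) F ≈ Σ< a F ⊞ Σ< b (λ i → F (a + i))
  Σ<-split zero b F = ≈sym (+-identityˡ _)
  Σ<-split (suc a) b F = ≈trans (+-congˡ (Σ<-split a b (F ∘ suc))) (≈sym (+-assoc (F 0) _ _))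

  Σ<-last : ∀ n (F : ℕ → Carrier) → Σ< (suc n) F ≈ Σ< n F ⊞ F n
  Σ<-last n F = ≈trans (≡→≈ (cong (λ m → Σ< m F) (ℕₚ.+-comm 1 n)))
                 (≈trans (Σ<-split n 1 F) (+-congˡ (≈trans (+-identityʳ _) (≡→≈ (cong F (ℕₚ.+-identityʳ n))))))

  Σ<-swap : ∀ a b (F : ℕ → ℕ → Carrier) → Σ< a (λ i → Σ< b (λ j → F i j)) ≈ Σ< b (λ j → Σ< a (λ i → F i j))
  Σ<-swap zero b F = ≈sym (Σ<-zero b (λ _ → 0#) (λ _ _ → ≈refl))
  Σ<-swap (suc a) b F = ≈trans (+-congˡ (Σ<-swap a b (F ∘ suc))) (≈sym (Σ<-+ b (λ j → F 0 j) (λ j → Σ< a (λ i → F (suc i) j))))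

  x-0≈x : ∀ x → x - 0# ≈ x
  x-0≈x x = ≈trans (+-congˡ ε⁻¹≈ε) (+-identityʳ x)

  u+w-u≈w : ∀ u w → (u ⊞ w) - u ≈ w
  u+w-u≈w = xyx⁻¹≈y

  x≈y+z⇒y≈x-z : ∀ {x y z} → x ≈ y ⊞ z → y ≈ x - z
  x≈y+z⇒y≈x-z {x} {y} {z} h = ≈trans (≈sym (+-identityʳ y)) (≈trans (+-congˡ (≈sym (-‿inverseʳ z)))
                                (≈trans (≈sym (+-assoc y z (- z))) (+-congʳ (≈sym h))))

  [x-y]+[u-w] : ∀ x y u w → (x - y) ⊞ (u - w) ≈ (u ⊞ x) - (w ⊞ y)
  [x-y]+[u-w] x y u w = ≈trans (shuffle x (- y) u (- w)) (+-congˡ (⁻¹-∙-comm w y))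
    where
    shuffle : ∀ x yn u wn → (x ⊞ yn) ⊞ (u ⊞ wn) ≈ (u ⊞ x) ⊞ (wn ⊞ yn)
    shuffle = solve 4 (λ x yn u wn → (x :+ yn) :+ (u :+ wn) := (u :+ x) :+ (wn :+ yn)) ≈refl

  [x-[y+z]]+z : ∀ x y z → (x - (y ⊞ z)) ⊞ z ≈ x - y
  [x-[y+z]]+z x y z = ≈trans (+-congʳ (+-congˡ (≈sym (⁻¹-∙-comm y z))))
                        (≈trans (reassoc x (- y) (- z) z) (+-congˡ (≈trans (+-congˡ (-‿inverseˡ z)) (+-identityʳ (- y)))))
    where
    reassoc : ∀ f gn zn z → (f ⊞ (gn ⊞ zn)) ⊞ z ≈ f ⊞ (gn ⊞ (zn ⊞ z))
    reassoc = solve 4 (λ f gn zn z → (f :+ (gn :+ zn)) :+ z := f :+ (gn :+ (zn :+ z))) ≈refl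

-- Each coefficient of  xmul a F  is either 0 or a
-- coefficient of F at a lowered exponent (xmul-view); from this, xmul is a congruence,
-- additive, commutes with coefficientwise scalings, and two such multiplications commute.
module Monomials {c ℓ} (R : CommutativeRing c ℓ) where
  open CommutativeRing R renaming (_+_ to _⊞_; refl to ≈refl; sym to ≈sym; trans to ≈trans)
  open Q R
  open RingSums R using (≡→≈)

  scaleN : ∀ {N} → (ℕ → Carrier) → Series N → Series N
  scaleN k F α n = k n * F α n

  Ext : ∀ {N} → Series N → Set ℓ
  Ext {N} F = ∀ (α α' : Fin N → ℕ) → (∀ i → α i ≡ α' i) → ∀ n → F α n ≈ F α' n

  xmul-just : ∀ {N} a (F : Series N) α n p → toFin? N (pred a) ≡ just p →
    xmul a F α n ≡ (if α p ≡ᵇ 0 then 0# else F (lowerAt p α) n)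
  xmul-just {N} a F α n p eq with toFin? N (pred a)
  xmul-just {N} a F α n p refl | .(just p) = refl

  xmul-nothing : ∀ {N} a (F : Series N) α n → toFin? N (pred a) ≡ nothing → xmul a F α n ≡ 0#
  xmul-nothing {N} a F α n eq with toFin? N (pred a)
  xmul-nothing {N} a F α n refl | .nothing = refl

  XmulView : ∀ {N} → ℕ → (Fin N → ℕ) → Set c
  XmulView {N} a α = (∀ (G : Series N) n → xmul a G α n ≡ 0#)
                   ⊎ Σ (Fin N → ℕ) (λ α' → ∀ (G : Series N) n → xmul a G α n ≡ G α' n)

  xmul-view : ∀ {N} a α → XmulView {N} a α
  xmul-view {N} a α = byPosition (toFin? N (pred a)) refl
    where
    byPosition : ∀ m → toFin? N (pred a) ≡ m → XmulView a α
    byPosition nothing eq = inj₁ (λ G n → xmul-nothing a G α n eq)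
    byPosition (just p) eq = byExponent (α p ≡ᵇ 0) refl
      where
      byExponent : ∀ b → (α p ≡ᵇ 0) ≡ b → XmulView a α
      byExponent true e0 = inj₁ (λ G n → trans (xmul-just a G α n p eq) (cong (λ b → if b then 0# else G (lowerAt p α) n) e0))
      byExponent false e0 = inj₂ (lowerAt p α , λ G n → trans (xmul-just a G α n p eq) (cong (λ b → if b then 0# else G (lowerAt p α) n) e0))

  xmul-cong : ∀ {N} a {F G : Series N} → F ≋ G → xmul a F ≋ xmul a G
  xmul-cong a {F} {G} h α n with xmul-view a α
  ... | inj₁ z = ≡→≈ (trans (z F n) (sym (z G n)))
  ... | inj₂ (α' , e) = ≈trans (≡→≈ (e F n)) (≈trans (h α' n) (≡→≈ (sym (e G n))))

  xmul-⊕ : ∀ {N} a (F G : Series N) → xmul a (F ⊕ G) ≋ (xmul a F ⊕ xmul a G)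
  xmul-⊕ a F G α n with xmul-view a α
  ... | inj₁ z = ≈trans (≡→≈ (z (F ⊕ G) n)) (≈sym (≈trans (+-cong (≡→≈ (z F n)) (≡→≈ (z G n))) (+-identityˡ 0#)))
  ... | inj₂ (α' , e) = ≈trans (≡→≈ (e (F ⊕ G) n)) (≈sym (+-cong (≡→≈ (e F n)) (≡→≈ (e G n))))

  xmul-⊖ : ∀ {N} a (F G : Series N) → xmul a (F ⊖ G) ≋ (xmul a F ⊖ xmul a G)
  xmul-⊖ a F G α n with xmul-view a α
  ... | inj₁ z = ≈trans (≡→≈ (z (F ⊖ G) n)) (≈sym (≈trans (+-cong (≡→≈ (z F n)) (-‿cong (≡→≈ (z G n)))) (-‿inverseʳ 0#)))
  ... | inj₂ (α' , e) = ≈trans (≡→≈ (e (F ⊖ G) n)) (≈sym (+-cong (≡→≈ (e F n)) (-‿cong (≡→≈ (e G n)))))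

  xmul-scaleN : ∀ {N} a k (F : Series N) → xmul a (scaleN k F) ≋ scaleN k (xmul a F)
  xmul-scaleN a k F α n with xmul-view a α
  ... | inj₁ z = ≈trans (≡→≈ (z (scaleN k F) n)) (≈sym (≈trans (*-congˡ (≡→≈ (z F n))) (zeroʳ _)))
  ... | inj₂ (α' , e) = ≈trans (≡→≈ (e (scaleN k F) n)) (*-congˡ (≡→≈ (sym (e F n))))

  xmul-comm : ∀ {N} a b (F : Series N) → Ext F → xmul a (xmul b F) ≋ xmul b (xmul a F)
  xmul-comm {N} a b F ext α n = byPositions (toFin? N (pred a)) (toFin? N (pred b)) refl refl
    where
    byPositions : ∀ ma mb → toFin? N (pred a) ≡ ma → toFin? N (pred b) ≡ mb → xmul a (xmul b F) α n ≈ xmul b (xmul a F) α n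
    byPositions nothing _ ea eb = ≡→≈ (trans (xmul-nothing a (xmul b F) α n ea) (sym vanish))
      where
      vanish : xmul b (xmul a F) α n ≡ 0#
      vanish with xmul-view b α
      ... | inj₁ z = z (xmul a F) n
      ... | inj₂ (α' , e) = trans (e (xmul a F) n) (xmul-nothing a F α' n ea)
    byPositions (just p) nothing ea eb = ≡→≈ (trans vanish (sym (xmul-nothing b (xmul a F) α n eb)))
      where
      vanish : xmul a (xmul b F) α n ≡ 0#
      vanish with xmul-view a α
      ... | inj₁ z = z (xmul b F) n
      ... | inj₂ (α' , e) = trans (e (xmul b F) n) (xmul-nothing b F α' n eb)
    byPositions (just p) (just p') ea eb with toℕ p ℕₚ.≟ toℕ p'
    ... | yes e with Finₚ.toℕ-injective e
    ...   | refl rewrite xmul-just a (xmul b F) α n p ea | xmul-just b (xmul a F) α n p eb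
                       | xmul-just b F (lowerAt p α) n p eb | xmul-just a F (lowerAt p α) n p ea = ≈refl
    byPositions (just p) (just p') ea eb | no ne
      rewrite xmul-just a (xmul b F) α n p ea | xmul-just b (xmul a F) α n p' eb
            | xmul-just b F (lowerAt p α) n p' eb | xmul-just a F (lowerAt p' α) n p ea
            | lowerAt-other p p' α ne | lowerAt-other p' p α (λ e → ne (sym e))
            with α p ≡ᵇ 0 | α p' ≡ᵇ 0
    ... | true | true = ≈refl
    ... | true | false = ≈refl
    ... | false | true = ≈refl
    ... | false | false = ext _ _ (lowerAt-comm p p' α ne) n

-- The falling q-factorial
-- [n]_i = [n][n−1]⋯[n−i+1] is the factor by which z^i D_q^i multiplies z^n, and the
-- q-Stirling numbers expand powers of [n] in this basis:  Σ_i S_q(m,i) [n]_i = [n]^m.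
module QStirling {c ℓ} (R : CommutativeRing c ℓ) (q : CommutativeRing.Carrier R) where
  open CommutativeRing R renaming (_+_ to _⊞_; refl to ≈refl; sym to ≈sym; trans to ≈trans)
  open Q R
  open RingSums R
  open import Relation.Binary.Reasoning.Setoid setoid

  pow-+ : ∀ x i k → pow x (i + k) ≈ pow x i * pow x k
  pow-+ x zero k = ≈sym (*-identityˡ _)
  pow-+ x (suc i) k = ≈trans (*-congˡ (pow-+ x i k)) (≈sym (*-assoc x _ _))

  qint-+ : ∀ i k → qint q (i + k) ≈ qint q i ⊞ pow q i * qint q k
  qint-+ i k = begin
      qint q (i + k)                                    ≡⟨ sumR-upTo (i + k) (pow q) ⟩
      Σ< (i + k) (pow q)                                ≈⟨ Σ<-split i k (pow q) ⟩
      Σ< i (pow q) ⊞ Σ< k (λ m → pow q (i + m))         ≈⟨ +-congˡ (Σ<-cong k (λ m _ → pow-+ q i m)) ⟩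
      Σ< i (pow q) ⊞ Σ< k (λ m → pow q i * pow q m)     ≈⟨ +-congˡ (Σ<-* k (pow q i) (pow q)) ⟩
      Σ< i (pow q) ⊞ pow q i * Σ< k (pow q)             ≡⟨ sym (cong₂ (λ x y → x ⊞ pow q i * y) (sumR-upTo i (pow q)) (sumR-upTo k (pow q))) ⟩
      qint q i ⊞ pow q i * qint q k                     ∎

  fall : ℕ → ℕ → Carrier
  fall zero n = 1#
  fall (suc i) n = qint q n * fall i (pred n)

  fall-vanishes : ∀ i n → n < i → fall i n ≈ 0#
  fall-vanishes (suc i) zero _ = zeroˡ _
  fall-vanishes (suc i) (suc n) (s≤s n<i) = ≈trans (*-congˡ (fall-vanishes i n n<i)) (zeroʳ _)

  fall-suc : ∀ i n → fall (suc i) n ≈ fall i n * qint q (n ∸ i)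
  fall-suc zero n = *-comm _ _
  fall-suc (suc i) n =
    ≈trans (*-congˡ (fall-suc i (pred n)))
           (≈trans (≈sym (*-assoc _ _ _)) (*-congˡ (≡→≈ (cong (qint q) (pred∸ n i)))))
    where
    pred∸ : ∀ n i → pred n ∸ i ≡ n ∸ suc i
    pred∸ zero i = ℕₚ.0∸n≡0 i
    pred∸ (suc n) i = refl

  -- [n] [n]_i = [i] [n]_i + q^i [n]_{i+1}: the recursion mirrored by S_q.
  fall-recursion : ∀ i n → qint q n * fall i n ≈ qint q i * fall i n ⊞ pow q i * fall (suc i) n
  fall-recursion i n with n <? i
  ... | yes n<i = ≈trans (≈trans (*-congˡ (fall-vanishes i n n<i)) (zeroʳ _))
                         (≈sym (≈trans (+-cong (≈trans (*-congˡ (fall-vanishes i n n<i)) (zeroʳ _))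
                                               (≈trans (*-congˡ (fall-vanishes (suc i) n (ℕₚ.m<n⇒m<1+n n<i))) (zeroʳ _)))
                                       (+-identityˡ 0#)))
  ... | no n≮i = subst (λ n → qint q n * fall i n ≈ qint q i * fall i n ⊞ pow q i * fall (suc i) n)
                   (ℕₚ.m+[n∸m]≡n (ℕₚ.≮⇒≥ n≮i)) (atLeast (n ∸ i))
    where
    atLeast : ∀ k → qint q (i + k) * fall i (i + k) ≈ qint q i * fall i (i + k) ⊞ pow q i * fall (suc i) (i + k)
    atLeast k = begin
        qint q (i + k) * fall i (i + k)                                   ≈⟨ *-congʳ (qint-+ i k) ⟩
        (qint q i ⊞ pow q i * qint q k) * fall i (i + k)                  ≈⟨ distribʳ _ _ _ ⟩
        qint q i * fall i (i + k) ⊞ pow q i * qint q k * fall i (i + k)   ≈⟨ +-congˡ (*-assoc _ _ _) ⟩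
        qint q i * fall i (i + k) ⊞ pow q i * (qint q k * fall i (i + k)) ≈⟨ +-congˡ (*-congˡ (*-comm _ _)) ⟩
        qint q i * fall i (i + k) ⊞ pow q i * (fall i (i + k) * qint q k)
          ≈⟨ +-congˡ (*-congˡ (≈sym (≈trans (fall-suc i (i + k)) (*-congˡ (≡→≈ (cong (qint q) (ℕₚ.m+n∸m≡n i k))))))) ⟩
        qint q i * fall i (i + k) ⊞ pow q i * fall (suc i) (i + k)        ∎

  Sq-vanishes : ∀ m k → m < k → Sq q m k ≈ 0#
  Sq-vanishes zero (suc k) _ = ≈refl
  Sq-vanishes (suc m) (suc k) (s≤s m<k) =
    ≈trans (+-cong (≈trans (*-congˡ (Sq-vanishes m k m<k)) (zeroʳ _))
                   (≈trans (*-congˡ (Sq-vanishes m (suc k) (ℕₚ.m<n⇒m<1+n m<k))) (zeroʳ _)))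
           (+-identityˡ 0#)

  stirling : ∀ m B n → m < B → Σ< B (λ i → Sq q m i * fall i n) ≈ pow (qint q n) m
  stirling zero (suc B) n _ = ≈trans (+-cong (*-identityˡ 1#) (Σ<-zero B _ (λ i _ → zeroˡ _))) (+-identityʳ 1#)
  stirling (suc m) (suc B) n (s≤s m<B) =
    begin
      Sq q (suc m) 0 * 1# ⊞ Σ< B (λ i → Sq q (suc m) (suc i) * fall (suc i) n)
    ≈⟨ ≈trans (+-congʳ (zeroˡ _)) (+-identityˡ _) ⟩
      Σ< B (λ i → (pow q i * Sq q m i ⊞ qint q (suc i) * Sq q m (suc i)) * fall (suc i) n)
    ≈⟨ Σ<-cong B (λ i _ → expand (pow q i) (Sq q m i) (qint q (suc i)) (Sq q m (suc i)) (fall (suc i) n)) ⟩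
      Σ< B (λ i → Lower i ⊞ Upper (suc i))
    ≈⟨ Σ<-+ B Lower (Upper ∘ suc) ⟩
      Σ< B Lower ⊞ Σ< B (Upper ∘ suc)
    ≈⟨ +-comm _ _ ⟩
      Σ< B (Upper ∘ suc) ⊞ Σ< B Lower
    ≈⟨ +-cong (≈sym (≈trans (+-congʳ upper0) (+-identityˡ _))) (≈sym (≈trans (Σ<-last B Lower) (≈trans (+-congˡ lowerB) (+-identityʳ _)))) ⟩
      Σ< (suc B) Upper ⊞ Σ< (suc B) Lower
    ≈⟨ ≈sym (Σ<-+ (suc B) Upper Lower) ⟩
      Σ< (suc B) (λ i → Upper i ⊞ Lower i)
    ≈⟨ Σ<-cong (suc B) (λ i _ → ≈trans (≈sym (distribˡ (Sq q m i) _ _)) (*-congˡ (≈sym (fall-recursion i n)))) ⟩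
      Σ< (suc B) (λ i → Sq q m i * (qint q n * fall i n))
    ≈⟨ Σ<-cong (suc B) (λ i _ → swap (Sq q m i) (qint q n) (fall i n)) ⟩
      Σ< (suc B) (λ i → qint q n * (Sq q m i * fall i n))
    ≈⟨ Σ<-* (suc B) (qint q n) (λ i → Sq q m i * fall i n) ⟩
      qint q n * Σ< (suc B) (λ i → Sq q m i * fall i n)
    ≈⟨ *-congˡ (stirling m (suc B) n (ℕₚ.m<n⇒m<1+n m<B)) ⟩
      qint q n * pow (qint q n) m
    ∎
    where
    Lower Upper : ℕ → Carrier
    Lower i = Sq q m i * (pow q i * fall (suc i) n)
    Upper i = Sq q m i * (qint q i * fall i n)
    upper0 : Upper 0 ≈ 0#
    upper0 = ≈trans (*-congˡ (zeroˡ (fall 0 n))) (zeroʳ (Sq q m 0))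
    lowerB : Lower B ≈ 0#
    lowerB = ≈trans (*-congʳ (Sq-vanishes m B m<B)) (zeroˡ _)
    expand : ∀ a b c d f → (a * b ⊞ c * d) * f ≈ b * (a * f) ⊞ d * (c * f)
    expand = solve 5 (λ a b c d f → (a :* b :+ c :* d) :* f := b :* (a :* f) :+ d :* (c :* f)) ≈refl
    swap : ∀ s a f → s * (a * f) ≈ a * (s * f)
    swap = solve 3 (λ s a f → s :* (a :* f) := a :* (s :* f)) ≈refl

  zDi-fall : ∀ {N} i (F : Series N) → zDi q i F ≋ (λ α n → fall i n * F α n)
  zDi-fall zero F α n = ≈sym (*-identityˡ _)
  zDi-fall (suc i) F α zero = ≈sym (≈trans (*-congʳ (zeroˡ _)) (zeroˡ _))
  zDi-fall (suc i) F α (suc m) =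
    ≈trans (≡→≈ (cong (λ G → iter i zmul G α m) (sym (iter-comm i (Dq q) F))))
           (≈trans (zDi-fall i (Dq q F) α m) (regroup (fall i m) (qint q (suc m)) (F α (suc m))))
    where
    iter-comm : ∀ {A : Set c} n (f : A → A) x → iter n f (f x) ≡ f (iter n f x)
    iter-comm zero f x = refl
    iter-comm (suc n) f x = cong f (iter-comm n f x)
    regroup : ∀ f a x → f * (a * x) ≈ (a * f) * x
    regroup = solve 3 (λ f a x → f :* (a :* x) := (a :* f) :* x) ≈refl

-- The q-derivative recurrence of the q-polylogarithms, coefficientwise: when inv m is an
-- inverse of [m], the coefficient of z^m in Li^t_{(a+1,kk)} times [m] is that of
-- Li^t_{(a,kk)} (that is, z D_q Li^t_{(a+1,kk)} = Li^t_{(a,kk)}), and constant terms vanish.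
module LiRecurrence {c ℓ} (R : CommutativeRing c ℓ) (q t : CommutativeRing.Carrier R)
         (inv : ℕ → CommutativeRing.Carrier R)
         (inv-qint : ∀ m → CommutativeRing._≈_ R (CommutativeRing._*_ R (Q.qint R q (suc m)) (inv (suc m))) (CommutativeRing.1# R))
         where
  open CommutativeRing R renaming (_+_ to _⊞_; refl to ≈refl; sym to ≈sym; trans to ≈trans)
  open Q R
  open Q.L R q t inv
  open RingSums R
  open import Relation.Binary.Reasoning.Setoid setoid

  liCoef-step : ∀ m a kk → qint q (suc m) * liCoef (suc a ∷ kk) (suc m) ≈ liCoef (a ∷ kk) (suc m)
  liCoef-step m a kk =
    begin
      qint q (suc m) * ((inv (suc m) * pow (inv (suc m)) a) * tailCoef kk (suc m))
    ≈⟨ regroup (qint q (suc m)) (inv (suc m)) (pow (inv (suc m)) a) (tailCoef kk (suc m)) ⟩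
      (qint q (suc m) * inv (suc m)) * (pow (inv (suc m)) a * tailCoef kk (suc m))
    ≈⟨ *-congʳ (inv-qint m) ⟩
      1# * (pow (inv (suc m)) a * tailCoef kk (suc m))
    ≈⟨ *-identityˡ _ ⟩
      pow (inv (suc m)) a * tailCoef kk (suc m)
    ∎
    where
    regroup : ∀ a b c d → a * ((b * c) * d) ≈ (a * b) * (c * d)
    regroup = solve 4 (λ a b c d → a :* ((b :* c) :* d) := (a :* b) :* (c :* d)) ≈refl

  accSum : ℕ → ℕ → ℕ → List ℕ → Carrier
  accSum L n a kk = sumR (map (λ p → liCoef p n * pow t (L ∸ length p)) (compAcc a kk))

  -- Every compression of (a+1, kk) has first part one more than the corresponding
  -- compression of (a, kk), so the recurrence passes through the sum over compressions.
  accSum-step : ∀ L m a kk → qint q (suc m) * accSum L (suc m) (suc a) kk ≈ accSum L (suc m) a kk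
  accSum-step L m a [] = ≈trans (distribˡ _ _ _) (+-cong (≈trans (≈sym (*-assoc _ _ _)) (*-congʳ (liCoef-step m a []))) (zeroʳ _))
  accSum-step L m a (k ∷ kk) =
    begin
      [m] * sumR (map h (map (suc a ∷_) (compAcc k kk) ++ compAcc (suc a + k) kk))
    ≈⟨ *-congˡ (split (suc a)) ⟩
      [m] * (sumR (map h (map (suc a ∷_) (compAcc k kk))) ⊞ accSum L (suc m) (suc (a + k)) kk)
    ≈⟨ distribˡ _ _ _ ⟩
      [m] * sumR (map h (map (suc a ∷_) (compAcc k kk))) ⊞ [m] * accSum L (suc m) (suc (a + k)) kk
    ≈⟨ +-cong separated (accSum-step L m (a + k) kk) ⟩
      sumR (map h (map (a ∷_) (compAcc k kk))) ⊞ accSum L (suc m) (a + k) kk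
    ≈⟨ ≈sym (split a) ⟩
      sumR (map h (map (a ∷_) (compAcc k kk) ++ compAcc (a + k) kk))
    ∎
    where
    [m] = qint q (suc m)
    h = λ p → liCoef p (suc m) * pow t (L ∸ length p)
    split : ∀ b → sumR (map h (map (b ∷_) (compAcc k kk) ++ compAcc (b + k) kk))
                  ≈ sumR (map h (map (b ∷_) (compAcc k kk))) ⊞ accSum L (suc m) (b + k) kk
    split b = ≈trans (≡→≈ (cong sumR (Listₚ.map-++ h (map (b ∷_) (compAcc k kk)) (compAcc (b + k) kk))))
                     (sumR-++ (map h (map (b ∷_) (compAcc k kk))) _)
    separated : [m] * sumR (map h (map (suc a ∷_) (compAcc k kk))) ≈ sumR (map h (map (a ∷_) (compAcc k kk)))
    separated = ≈trans (≈sym (sumR-* [m] h (map (suc a ∷_) (compAcc k kk))))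
                (≈trans (≡→≈ (sumR-map-map (λ p → [m] * h p) (suc a ∷_) (compAcc k kk)))
                (≈trans (sumR-cong _ _ (compAcc k kk) (λ p → ≈trans (≈sym (*-assoc _ _ _)) (*-congʳ (liCoef-step m a p))))
                (≡→≈ (sym (sumR-map-map h (a ∷_) (compAcc k kk))))))

  liTCoef-step : ∀ m a kk → qint q (suc m) * liTCoef (suc a ∷ kk) (suc m) ≈ liTCoef (a ∷ kk) (suc m)
  liTCoef-step m a kk = accSum-step (suc (length kk)) m a kk

  accSum-zero : ∀ L a kk → accSum L 0 a kk ≈ 0#
  accSum-zero L a [] = ≈trans (+-identityʳ _) (zeroˡ _)
  accSum-zero L a (k ∷ kk) =
    ≈trans (≡→≈ (cong sumR (Listₚ.map-++ h (map (a ∷_) (compAcc k kk)) (compAcc (a + k) kk))))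
    (≈trans (sumR-++ (map h (map (a ∷_) (compAcc k kk))) _)
    (≈trans (+-cong (≈trans (≡→≈ (sumR-map-map h (a ∷_) (compAcc k kk))) (sumR-zero _ (compAcc k kk) (λ p → zeroˡ _)))
                    (accSum-zero L (a + k) kk))
    (+-identityˡ 0#)))
    where
    h = λ p → liCoef p 0 * pow t (L ∸ length p)

  liTCoef-zero : ∀ a kk → liTCoef (a ∷ kk) 0 ≈ 0#
  liTCoef-zero a kk = accSum-zero (suc (length kk)) a kk

module FilteredSums {c ℓ} (R : CommutativeRing c ℓ) (r' : ℕ) where
  open CommutativeRing R renaming (_+_ to _⊞_; refl to ≈refl; sym to ≈sym; trans to ≈trans)
  open Q R
  open RingSums R
  open ExponentCode r'
  open import Relation.Binary.Reasoning.Setoid setoid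

  Filt : (List ℕ → Carrier) → (ℕ → ℕ) → List ℕ → Carrier
  Filt f β kk = if agreeOn N (expOf kk) β then f kk else 0#

  candidates : (ℕ → ℕ) → List (List ℕ)
  candidates β = comps (weightOf β) (depthOf β)

  Ser : (List ℕ → Carrier) → (ℕ → ℕ) → Carrier
  Ser f β = sumR (map (Filt f β) (candidates β))

  if-0 : ∀ (b : Bool) → (if b then 0# else 0#) ≈ 0#
  if-0 true = ≈refl
  if-0 false = ≈refl

  heightFiltered≈Ser : ∀ β (B : List ℕ → Bool) (F : List ℕ → Carrier) →
    sumR (map (λ kk → if eqList (heights r kk) (heightsOf β) ∧ B kk then F kk else 0#) (candidates β))
    ≈ Ser (λ kk → if B kk then F kk else 0#) β
  heightFiltered≈Ser β B F = sumR-congAll _ _ (comps-IsIndex (weightOf β) (depthOf β)) termwise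
    where
    termwise : ∀ kk → IsIndex (weightOf β) (depthOf β) kk →
      (if eqList (heights r kk) (heightsOf β) ∧ B kk then F kk else 0#) ≈ Filt (λ kk → if B kk then F kk else 0#) β kk
    termwise kk isIdx rewrite heightTest≡agree β kk isIdx with agreeOn N (expOf kk) β
    ... | true = ≈refl
    ... | false = ≈refl

  Ser-ext : ∀ f {β γ} → (∀ i → β i ≡ γ i) → Ser f β ≈ Ser f γ
  Ser-ext f {β} {γ} h =
    ≈trans (≡→≈ (cong₂ (λ k l → sumR (map (Filt f β) (comps k l))) (weight≡ s) (depth≡ s)))
           (sumR-cong _ _ (candidates γ) (λ kk → ≡→≈ (cong (λ b → if b then f kk else 0#) (agreeOn-cong N {expOf kk} {expOf kk} (λ _ → refl) h))))
    where
    s = shift-cong {β} {γ} (λ i _ → h i)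

  Ser-cong : ∀ {f g} β → (∀ kk → f kk ≈ g kk) → Ser f β ≈ Ser g β
  Ser-cong {f} {g} β h = sumR-cong _ _ (candidates β) termwise
    where
    termwise : ∀ kk → Filt f β kk ≈ Filt g β kk
    termwise kk with agreeOn N (expOf kk) β
    ... | true = h kk
    ... | false = ≈refl

  Ser-+ : ∀ f g β → Ser (λ kk → f kk ⊞ g kk) β ≈ Ser f β ⊞ Ser g β
  Ser-+ f g β = ≈trans (sumR-cong _ _ (candidates β) termwise) (sumR-+ (Filt f β) (Filt g β) (candidates β))
    where
    termwise : ∀ kk → Filt (λ kk → f kk ⊞ g kk) β kk ≈ Filt f β kk ⊞ Filt g β kk
    termwise kk with agreeOn N (expOf kk) β
    ... | true = ≈refl
    ... | false = ≈sym (+-identityˡ 0#)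

  Ser-* : ∀ k f β → Ser (λ kk → k * f kk) β ≈ k * Ser f β
  Ser-* k f β = ≈trans (sumR-cong _ _ (candidates β) termwise) (sumR-* k (Filt f β) (candidates β))
    where
    termwise : ∀ kk → Filt (λ kk → k * f kk) β kk ≈ k * Filt f β kk
    termwise kk with agreeOn N (expOf kk) β
    ... | true = ≈refl
    ... | false = ≈sym (zeroʳ k)

  Ser-0 : ∀ f β → (∀ kk → f kk ≈ 0#) → Ser f β ≈ 0#
  Ser-0 f β h = sumR-zero _ (candidates β) termwise
    where
    termwise : ∀ kk → Filt f β kk ≈ 0#
    termwise kk with agreeOn N (expOf kk) β
    ... | true = h kk
    ... | false = ≈refl

  partExp-large : ∀ v → suc r ≤ v → ∀ i → partExp v i ≡ kron (suc r) i + kron 0 i *ℕ (v ∸ suc r)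
  partExp-large (suc (suc c)) (s≤s (s≤s r'≤c)) i with c <? r
  ... | no c≮r = partExp-big c (ℕₚ.≮⇒≥ c≮r) i
  ... | yes (s≤s c≤r') with ℕₚ.≤-antisym c≤r' r'≤c
  ...   | refl = trans (partExp-unit (suc (suc c)) ℕₚ.≤-refl i)
                   (sym (trans (cong (λ x → kron (suc r) i + kron 0 i *ℕ x) (ℕₚ.n∸n≡0 c))
                        (trans (cong (kron (suc r) i +_) (ℕₚ.*-zeroʳ (kron 0 i))) (ℕₚ.+-identityʳ _))))

  partExp-grow : ∀ p → r ≤ p → ∀ i → partExp (suc (suc p)) i ≡ kron 0 i + partExp (suc p) i
  partExp-grow p r≤p i =
    trans (partExp-large (suc (suc p)) (s≤s (ℕₚ.m≤n⇒m≤1+n r≤p)) i)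
    (trans (cong (λ x → kron (suc r) i + kron 0 i *ℕ x) (ℕₚ.+-∸-assoc 1 r≤p))
    (trans (cong (kron (suc r) i +_) (ℕₚ.*-suc (kron 0 i) (p ∸ r)))
    (trans (swap (kron (suc r) i) (kron 0 i) (kron 0 i *ℕ (p ∸ r)))
    (cong (kron 0 i +_) (sym (partExp-large (suc p) (s≤s r≤p) i))))))
    where
    swap : ∀ a b c → a + (b + c) ≡ b + (a + c)
    swap = solve-∀

  shift-unit : ∀ v {β γ} → 1 ≤ v → v ≤ suc r → (∀ i → β i ≡ kron v i + γ i) →
    weightOf β ≡ v + weightOf γ × depthOf β ≡ suc (depthOf γ)
  shift-unit (suc zero) _ _ h = weight≡ s , depth≡ s
    where s = shift-part1 h
  shift-unit (suc (suc c)) _ (s≤s (s≤s c≤r')) h = weight≡ s , depth≡ s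
    where s = shift-part c (s≤s c≤r') h

  -- Indices starting with a part v ∈ [1, r+1] contribute to x^β only through x_{v+1} x^{β'},
  -- where β' is β lowered at v; in particular not at all when β v = 0.
  Ser-headIs-absent : ∀ v → v ≤ suc r → (f : List ℕ → Carrier) (β : ℕ → ℕ) → β v ≡ 0 →
    Ser (λ kk → if headIs v kk then f kk else 0#) β ≈ 0#
  Ser-headIs-absent v v≤ f β βv = sumR-zero _ (candidates β) noHead
    where
    noHead : ∀ kk → Filt (λ kk → if headIs v kk then f kk else 0#) β kk ≈ 0#
    noHead [] = if-0 (agreeOn N (expOf []) β)
    noHead (k ∷ kk) with k ≡ᵇ v in kv
    ... | false = if-0 (agreeOn N (expOf (k ∷ kk)) β)
    ... | true with agreeOn N (expOf (k ∷ kk)) β in agree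
    ...   | false = ≈refl
    ...   | true = ⊥-elim (ℕₚ.1+n≢0 (trans (sym exp≡) (trans (agreeOn-sound N (expOf (k ∷ kk)) β agree v (s≤s v≤)) βv)))
      where
      exp≡ : expOf (k ∷ kk) v ≡ suc (expOf kk v)
      exp≡ rewrite ≡ᵇ-sound k v kv | partExp-unit v v≤ v | kron-diag v = refl

  Ser-headIs-present : ∀ v₀ → suc v₀ ≤ suc r → (f : List ℕ → Carrier) (β : ℕ → ℕ) → ∀ c → β (suc v₀) ≡ suc c →
    Ser (λ kk → if headIs (suc v₀) kk then f kk else 0#) β ≈ Ser (λ kk → f (suc v₀ ∷ kk)) (lowerℕ (suc v₀) β)
  Ser-headIs-present v₀ v≤ f β c βv =
    begin
      sumR (map (Filt g β) (comps (weightOf β) (depthOf β)))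
    ≡⟨ cong₂ (λ a b → sumR (map (Filt g β) (comps a b))) (proj₁ shifted) (proj₂ shifted) ⟩
      sumR (map (Filt g β) (comps (v + K) (suc L)))
    ≡⟨ cong (λ x → sumR (map (Filt g β) x)) (comps-suc (v + K) L) ⟩
      sumR (map (Filt g β) (concatMap (λ p → map (suc p ∷_) (comps (v + K ∸ suc p) L)) (upTo (v + K))))
    ≈⟨ sumR-concatMap (Filt g β) (λ p → map (suc p ∷_) (comps (v + K ∸ suc p) L)) (upTo (v + K)) ⟩
      sumR (map ByHead (upTo (v + K)))
    ≡⟨ sumR-upTo (v + K) ByHead ⟩
      Σ< (v + K) ByHead
    ≈⟨ Σ<-single (v + K) v₀ ByHead (s≤s (ℕₚ.m≤m+n v₀ K)) otherHeads ⟩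
      ByHead v₀
    ≡⟨ trans (sumR-map-map (Filt g β) (v ∷_) (comps (v + K ∸ v) L))
             (cong (λ x → sumR (map (Filt g β ∘ (v ∷_)) (comps x L))) (ℕₚ.m+n∸m≡n v K)) ⟩
      sumR (map (Filt g β ∘ (v ∷_)) (comps K L))
    ≈⟨ sumR-cong _ _ (comps K L) headV ⟩
      Ser (λ kk → f (v ∷ kk)) γ
    ∎
    where
    v = suc v₀
    γ = lowerℕ v β
    βsplit = lowerℕ-split v β c βv
    shifted = shift-unit v {β} {γ} (s≤s z≤n) v≤ βsplit
    K = weightOf γ
    L = depthOf γ
    g = λ kk → if headIs v kk then f kk else 0#
    ByHead : ℕ → Carrier
    ByHead p = sumR (map (Filt g β) (map (suc p ∷_) (comps (v + K ∸ suc p) L)))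
    otherHeads : ∀ p → p ≢ v₀ → ByHead p ≈ 0#
    otherHeads p p≢v₀ = ≈trans (≡→≈ (sumR-map-map (Filt g β) (suc p ∷_) (comps (v + K ∸ suc p) L)))
                               (sumR-zero _ (comps (v + K ∸ suc p) L) excluded)
      where
      excluded : ∀ kk → Filt g β (suc p ∷ kk) ≈ 0#
      excluded kk rewrite ≡ᵇ-false p v₀ p≢v₀ = if-0 (agreeOn N (expOf (suc p ∷ kk)) β)
    headV : ∀ kk → Filt g β (v ∷ kk) ≈ Filt (λ kk → f (v ∷ kk)) γ kk
    headV kk rewrite ≡ᵇ-refl v₀
                   | agreeOn-shift N (kron v) {expOf (v ∷ kk)} {expOf kk} (λ i → cong (_+ expOf kk i) (partExp-unit v v≤ i)) βsplit = ≈refl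

  Ser-headIs : ∀ v → 1 ≤ v → v ≤ suc r → (f : List ℕ → Carrier) (β : ℕ → ℕ) →
    Ser (λ kk → if headIs v kk then f kk else 0#) β ≈ (if β v ≡ᵇ 0 then 0# else Ser (λ kk → f (v ∷ kk)) (lowerℕ v β))
  Ser-headIs (suc v₀) _ v≤ f β with β (suc v₀) in βv
  ... | zero = Ser-headIs-absent (suc v₀) v≤ f β βv
  ... | suc c = Ser-headIs-present v₀ v≤ f β c βv

  -- Indices with first part ≥ r+2 contribute to x^β only through x_1 x^{β'} (β' = β lowered
  -- at x_1), and they correspond to the indices with first part ≥ r+1 lowered by one.
  Ser-raise-absent : (f : List ℕ → Carrier) (β : ℕ → ℕ) → β 0 ≡ 0 →
    Ser (λ kk → if headOK (suc r) kk then f kk else 0#) β ≈ 0#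
  Ser-raise-absent f β β0 = sumR-zero _ (candidates β) noBigHead
    where
    noBigHead : ∀ kk → Filt (λ kk → if headOK (suc r) kk then f kk else 0#) β kk ≈ 0#
    noBigHead [] = if-0 (agreeOn N (expOf []) β)
    noBigHead (k ∷ kk) with suc (suc r) ≤ᵇ k in big
    ... | false = if-0 (agreeOn N (expOf (k ∷ kk)) β)
    ... | true with agreeOn N (expOf (k ∷ kk)) β in agree
    ...   | false = ≈refl
    ...   | true = ⊥-elim (ℕₚ.<⇒≢ (ℕₚ.m<n⇒0<n∸m k>) (sym excess≡0))
      where
      k> : suc r < k
      k> = ℕₚ.≤ᵇ⇒≤ (suc (suc r)) k (≡true⇒T big)
      exp0 : expOf (k ∷ kk) 0 ≡ 0
      exp0 = trans (agreeOn-sound N (expOf (k ∷ kk)) β agree 0 (s≤s z≤n)) β0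
      excess≡0 : k ∸ suc r ≡ 0
      excess≡0 = trans (sym (ℕₚ.+-identityʳ (k ∸ suc r)))
                   (ℕₚ.m+n≡0⇒m≡0 (k ∸ suc r + 0) (subst (λ x → x + expOf kk 0 ≡ 0) (partExp-large k (ℕₚ.<⇒≤ k>) 0) exp0))

  Ser-raise-present : (f : List ℕ → Carrier) (β : ℕ → ℕ) → ∀ c → β 0 ≡ suc c →
    Ser (λ kk → if headOK (suc r) kk then f kk else 0#) β ≈ Ser (λ kk → if headOK r kk then f (raise kk) else 0#) (lowerℕ 0 β)
  Ser-raise-present f β c β0 =
    ≈trans (≡→≈ (cong₂ (λ a b → sumR (map (Filt gβ β) (comps a b))) (weight≡ s) (depth≡ s))) (byDepth (depthOf γ))
    where
    gβ = λ kk → if headOK (suc r) kk then f kk else 0#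
    gγ = λ kk → if headOK r kk then f (raise kk) else 0#
    γ = lowerℕ 0 β
    βsplit = lowerℕ-split 0 β c β0
    s = shift-x1 {β} {γ} 1 (λ i → trans (βsplit i) (cong (_+ γ i) (sym (ℕₚ.*-identityʳ (kron 0 i)))))
    K = weightOf γ
    byDepth : ∀ L → sumR (map (Filt gβ β) (comps (suc K) L)) ≈ sumR (map (Filt gγ γ) (comps K L))
    byDepth zero with K
    ... | zero = ≈sym (≈trans (+-identityʳ _) (if-0 (agreeOn N (expOf []) γ)))
    ... | suc _ = ≈refl
    byDepth (suc L') =
      begin
        sumR (map (Filt gβ β) (concatMap Gβ (upTo (suc K))))
      ≈⟨ sumR-concatMap (Filt gβ β) Gβ (upTo (suc K)) ⟩
        Inβ 0 ⊞ sumR (map Inβ (applyUpTo suc K))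
      ≈⟨ +-cong head1 (≡→≈ (cong sumR (Listₚ.map-applyUpTo suc Inβ K))) ⟩
        0# ⊞ Σ< K (Inβ ∘ suc)
      ≈⟨ +-identityˡ _ ⟩
        Σ< K (Inβ ∘ suc)
      ≈⟨ Σ<-cong K (λ p _ → lowered p) ⟩
        Σ< K Inγ
      ≡⟨ sym (sumR-upTo K Inγ) ⟩
        sumR (map Inγ (upTo K))
      ≈⟨ ≈sym (sumR-concatMap (Filt gγ γ) Gγ (upTo K)) ⟩
        sumR (map (Filt gγ γ) (concatMap Gγ (upTo K)))
      ≡⟨ cong (λ x → sumR (map (Filt gγ γ) x)) (sym (comps-suc K L')) ⟩
        sumR (map (Filt gγ γ) (comps K (suc L')))
      ∎
      where
      Gβ Gγ : ℕ → List (List ℕ)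
      Gβ p = map (suc p ∷_) (comps (suc K ∸ suc p) L')
      Gγ p = map (suc p ∷_) (comps (K ∸ suc p) L')
      Inβ Inγ : ℕ → Carrier
      Inβ p = sumR (map (Filt gβ β) (Gβ p))
      Inγ p = sumR (map (Filt gγ γ) (Gγ p))
      head1 : Inβ 0 ≈ 0#
      head1 = ≈trans (≡→≈ (sumR-map-map (Filt gβ β) (1 ∷_) (comps K L')))
                     (sumR-zero _ (comps K L') (λ kk → if-0 (agreeOn N (expOf (1 ∷ kk)) β)))
      termwise : ∀ p kk → Filt gβ β (suc (suc p) ∷ kk) ≈ Filt gγ γ (suc p ∷ kk)
      termwise p kk with r <ᵇ suc p in big
      ... | false = ≈trans (if-0 (agreeOn N (expOf (suc (suc p) ∷ kk)) β)) (≈sym (if-0 (agreeOn N (expOf (suc p ∷ kk)) γ)))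
      ... | true rewrite agreeOn-shift N (kron 0) {expOf (suc (suc p) ∷ kk)} {expOf (suc p ∷ kk)}
                   (λ i → trans (cong (_+ expOf kk i) (partExp-grow p (ℕₚ.≤-pred (ℕₚ.<ᵇ⇒< r (suc p) (≡true⇒T big))) i))
                                (ℕₚ.+-assoc (kron 0 i) _ _)) βsplit = ≈refl
      lowered : ∀ p → Inβ (suc p) ≈ Inγ p
      lowered p = ≈trans (≡→≈ (sumR-map-map (Filt gβ β) (suc (suc p) ∷_) (comps (K ∸ suc p) L')))
                  (≈trans (sumR-cong _ _ (comps (K ∸ suc p) L') (termwise p))
                          (≡→≈ (sym (sumR-map-map (Filt gγ γ) (suc p ∷_) (comps (K ∸ suc p) L')))))

  Ser-raise : (f : List ℕ → Carrier) (β : ℕ → ℕ) →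
    Ser (λ kk → if headOK (suc r) kk then f kk else 0#) β ≈
      (if β 0 ≡ᵇ 0 then 0# else Ser (λ kk → if headOK r kk then f (raise kk) else 0#) (lowerℕ 0 β))
  Ser-raise f β = byExponent (β 0) refl
    where
    byExponent : ∀ b → β 0 ≡ b → Ser (λ kk → if headOK (suc r) kk then f kk else 0#) β ≈
                                  (if b ≡ᵇ 0 then 0# else Ser (λ kk → if headOK r kk then f (raise kk) else 0#) (lowerℕ 0 β))
    byExponent zero β0 = Ser-raise-absent f β β0
    byExponent (suc c) β0 = Ser-raise-present f β c β0

  Ser-empty : ∀ (F : List ℕ → Carrier) β →
    Ser (λ kk → if isEmptyAt 0 kk then F kk else 0#) β ≈ (if agreeOn N (expOf []) β then F [] else 0#)
  Ser-empty F β with agreeOn N (expOf []) β in agree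
  ... | true = ≈trans (≡→≈ (cong₂ (λ a b → sumR (map (Filt g β) (comps a b))) w≡0 d≡0))
                      (≈trans (+-identityʳ (Filt g β [])) (≡→≈ (cong (λ b → if b then F [] else 0#) agree)))
    where
    g = λ kk → if isEmptyAt 0 kk then F kk else 0#
    s = shift-cong {β} {expOf []} (λ i i<N → sym (agreeOn-sound N (expOf []) β agree i i<N))
    d = expOf-decodes [] []
    w≡0 : weightOf β ≡ 0
    w≡0 = trans (weight≡ s) (weight-expOf d)
    d≡0 : depthOf β ≡ 0
    d≡0 = trans (depth≡ s) (depth-expOf d)
  ... | false = sumR-zero _ (candidates β) nonEmpty
    where
    g = λ kk → if isEmptyAt 0 kk then F kk else 0#
    nonEmpty : ∀ kk → Filt g β kk ≈ 0#
    nonEmpty [] rewrite agree = ≈refl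
    nonEmpty (k ∷ kk) = if-0 (agreeOn N (expOf (k ∷ kk)) β)

  head-split : ∀ j' (F : List ℕ → Carrier) kk →
    (if headOK j' kk then F kk else 0#) ≈
      (if isEmptyAt j' kk then F kk else 0#) ⊞ ((if headIs (suc j') kk then F kk else 0#) ⊞ (if headOK (suc j') kk then F kk else 0#))
  head-split j' F [] = ≈sym (≈trans (+-congˡ (+-identityˡ 0#)) (+-identityʳ _))
  head-split j' F (k ∷ kk) with ℕₚ.<-cmp k (suc j')
  ... | tri< k< _ _ rewrite ≤ᵇ-false (suc j') k (ℕₚ.<⇒≱ k<) | ≡ᵇ-false k (suc j') (ℕₚ.<⇒≢ k<)
                          | ≤ᵇ-false (suc (suc j')) k (λ h → ℕₚ.<⇒≱ k< (ℕₚ.≤-trans (ℕₚ.n≤1+n (suc j')) h)) =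
    ≈sym (≈trans (+-identityˡ _) (+-identityˡ 0#))
  ... | tri≈ _ refl _ rewrite T⇒≡true (ℕₚ.≤⇒≤ᵇ (ℕₚ.≤-refl {suc j'})) | ≡ᵇ-refl j' | ≤ᵇ-false (suc (suc j')) (suc j') (ℕₚ.<-irrefl refl) =
    ≈sym (≈trans (+-identityˡ _) (+-identityʳ _))
  ... | tri> _ _ k> rewrite T⇒≡true (ℕₚ.≤⇒≤ᵇ (ℕₚ.<⇒≤ k>)) | ≡ᵇ-false k (suc j') (λ e → ℕₚ.<⇒≢ k> (sym e)) | T⇒≡true (ℕₚ.≤⇒≤ᵇ k>) =
    ≈sym (≈trans (+-identityˡ _) (+-identityˡ _))

-- Since z^i D_q^i acts by [n]_i on z^n,
-- exchanging the two summations leaves Σ_i S_q(m,i)[n]_i = [n]^m in front of each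
-- x_{r+2−m} y₀ − x_1 x_{r+1−m} y₀, and the extra term of A^{(j)}_i supplies the last
-- lower term.
module RightHandSide {c ℓ} (R : CommutativeRing c ℓ) (q t : CommutativeRing.Carrier R)
         (inv : ℕ → CommutativeRing.Carrier R) (r' : ℕ) where
  open CommutativeRing R renaming (_+_ to _⊞_; refl to ≈refl; sym to ≈sym; trans to ≈trans)
  open Q R
  open Q.L R q t inv
  open RingSums R
  open ExponentCode r' using (r; N)
  open Monomials R
  open QStirling R q
  open import Relation.Binary.Reasoning.Setoid setoid

  y0 : Series N
  y0 = Φ r r

  lowerTerms : ℕ → (Fin N → ℕ) → ℕ → Carrier
  lowerTerms k α n = Σ< k (λ m → pow (qint q n) m * xmul 1 (xmul (r + 1 ∸ m) y0) α n)

  ΣS-eval : ∀ {A : Set} (G : A → Series N) xs α n → ΣS (map G xs) α n ≡ sumR (map (λ x → G x α n) xs)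
  ΣS-eval G [] α n = refl
  ΣS-eval G (x ∷ xs) α n = cong (G x α n ⊞_) (ΣS-eval G xs α n)

  module Collapse (j' : ℕ) (j'≤r : j' ≤ r) (α : Fin N → ℕ) (n : ℕ) where
    a : Carrier
    a = qint q n
    Rr : ℕ
    Rr = r ∸ j'
    X X1 : ℕ → Carrier
    X b = xmul b y0 α n
    X1 b = xmul 1 (xmul b y0) α n
    upper : ℕ → Carrier
    upper m = pow a m * X (r + 2 ∸ m)
    g : ℕ → Carrier
    g m = X (r + 2 ∸ m) - X1 (r + 1 ∸ m)
    term : ℕ → ℕ → Carrier
    term i m = Sq q m i * (fall i n * g m)

    AMul-eval : ∀ i → AMul r j' i (zDi q i y0) α n ≈ Σ< (suc (Rr ∸ i)) (λ d → term i (i + d)) ⊞ Sq q Rr i * (fall i n * X1 (j' + 1))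
    AMul-eval i = +-cong (≈trans (≡→≈ (trans (ΣS-eval Gd (upTo (suc (Rr ∸ i))) α n) (sumR-upTo (suc (Rr ∸ i)) (λ d → Gd d α n))))
                                 (Σ<-cong (suc (Rr ∸ i)) (λ d _ → *-congˡ {Sq q (i + d) i} (termD (i + d)))))
                         (*-congˡ (x1Z (j' + 1)))
      where
      Z = zDi q i y0
      Gd : ℕ → Series N
      Gd d = Sq q (i + d) i · (xmul (r + 2 ∸ (i + d)) Z ⊖ xmul 1 (xmul (r + 1 ∸ (i + d)) Z))
      xZ : ∀ b → xmul b Z α n ≈ fall i n * X b
      xZ b = ≈trans (xmul-cong b (zDi-fall i y0) α n) (xmul-scaleN b (fall i) y0 α n)
      x1Z : ∀ b → xmul 1 (xmul b Z) α n ≈ fall i n * X1 b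
      x1Z b = ≈trans (xmul-cong 1 (λ α' n' → ≈trans (xmul-cong b (zDi-fall i y0) α' n') (xmul-scaleN b (fall i) y0 α' n')) α n)
                     (xmul-scaleN 1 (fall i) (xmul b y0) α n)
      termD : ∀ m → xmul (r + 2 ∸ m) Z α n - xmul 1 (xmul (r + 1 ∸ m) Z) α n ≈ fall i n * g m
      termD m = ≈trans (+-cong (xZ (r + 2 ∸ m)) (-‿cong (x1Z (r + 1 ∸ m)))) (≈sym (x[y-z]≈xy-xz (fall i n) (X (r + 2 ∸ m)) (X1 (r + 1 ∸ m))))

    -- S_q(m, i) = 0 for m < i, so the inner sum may start at m = 0.
    fullRange : ∀ i → i ≤ Rr → Σ< (suc (Rr ∸ i)) (λ d → term i (i + d)) ≈ Σ< (suc Rr) (term i)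
    fullRange i i≤R = ≈sym (≈trans (≡→≈ (cong (λ k → Σ< k (term i)) (sym i+[R-i]≡)))
                            (≈trans (Σ<-split i (suc (Rr ∸ i)) (term i))
                            (≈trans (+-congʳ (Σ<-zero i (term i) (λ m m<i → ≈trans (*-congʳ (Sq-vanishes m i m<i)) (zeroˡ _))))
                            (+-identityˡ _))))
      where
      i+[R-i]≡ : i + suc (Rr ∸ i) ≡ suc Rr
      i+[R-i]≡ = trans (ℕₚ.+-suc i (Rr ∸ i)) (cong suc (ℕₚ.m+[n∸m]≡n i≤R))

    -- Exchanging the sums, each column is a q-Stirling expansion of [n]^m.
    mainPart : Σ< (suc Rr) (λ i → Σ< (suc (Rr ∸ i)) (λ d → term i (i + d))) ≈ Σ< (suc Rr) upper - lowerTerms (suc Rr) α n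
    mainPart = begin
        Σ< (suc Rr) (λ i → Σ< (suc (Rr ∸ i)) (λ d → term i (i + d)))  ≈⟨ Σ<-cong (suc Rr) (λ i i<sR → fullRange i (ℕₚ.≤-pred i<sR)) ⟩
        Σ< (suc Rr) (λ i → Σ< (suc Rr) (term i))                        ≈⟨ Σ<-swap (suc Rr) (suc Rr) term ⟩
        Σ< (suc Rr) (λ m → Σ< (suc Rr) (λ i → term i m))                ≈⟨ Σ<-cong (suc Rr) (λ m m<sR → stirlingColumn m m<sR) ⟩
        Σ< (suc Rr) (λ m → pow a m * g m)
          ≈⟨ Σ<-cong (suc Rr) (λ m _ → x[y-z]≈xy-xz (pow a m) (X (r + 2 ∸ m)) (X1 (r + 1 ∸ m))) ⟩
        Σ< (suc Rr) (λ m → upper m - pow a m * X1 (r + 1 ∸ m))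
          ≈⟨ Σ<-- (suc Rr) upper (λ m → pow a m * X1 (r + 1 ∸ m)) ⟩
        Σ< (suc Rr) upper - lowerTerms (suc Rr) α n                     ∎
      where
      stirlingColumn : ∀ m → m < suc Rr → Σ< (suc Rr) (λ i → term i m) ≈ pow a m * g m
      stirlingColumn m m<sR = ≈trans (Σ<-cong (suc Rr) (λ i _ → ≈sym (*-assoc (Sq q m i) (fall i n) (g m))))
                              (≈trans (Σ<-*ʳ (suc Rr) (g m) (λ i → Sq q m i * fall i n))
                                      (*-congʳ (stirling m (suc Rr) n m<sR)))

    extraPart : Σ< (suc Rr) (λ i → Sq q Rr i * (fall i n * X1 (j' + 1))) ≈ pow a Rr * X1 (j' + 1)
    extraPart = ≈trans (Σ<-cong (suc Rr) (λ i _ → ≈sym (*-assoc (Sq q Rr i) (fall i n) (X1 (j' + 1)))))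
                (≈trans (Σ<-*ʳ (suc Rr) (X1 (j' + 1)) (λ i → Sq q Rr i * fall i n))
                        (*-congʳ (stirling Rr (suc Rr) n (ℕₚ.n<1+n Rr))))

    lastIndex : r + 1 ∸ Rr ≡ j' + 1
    lastIndex = trans (ℕₚ.+-∸-comm 1 (ℕₚ.m∸n≤m r j')) (cong (_+ 1) (ℕₚ.m∸[m∸n]≡n j'≤r))

    RHS-collapse : RHS r j' α n ≈ Σ< (suc Rr) upper - lowerTerms Rr α n
    RHS-collapse =
      begin
        RHS r j' α n
      ≡⟨ trans (ΣS-eval (λ i → AMul r j' i (zDi q i y0)) (upTo (suc Rr)) α n) (sumR-upTo (suc Rr) (λ i → AMul r j' i (zDi q i y0) α n)) ⟩
        Σ< (suc Rr) (λ i → AMul r j' i (zDi q i y0) α n)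
      ≈⟨ Σ<-cong (suc Rr) (λ i _ → AMul-eval i) ⟩
        Σ< (suc Rr) (λ i → Σ< (suc (Rr ∸ i)) (λ d → term i (i + d)) ⊞ Sq q Rr i * (fall i n * X1 (j' + 1)))
      ≈⟨ Σ<-+ (suc Rr) (λ i → Σ< (suc (Rr ∸ i)) (λ d → term i (i + d))) (λ i → Sq q Rr i * (fall i n * X1 (j' + 1))) ⟩
        Σ< (suc Rr) (λ i → Σ< (suc (Rr ∸ i)) (λ d → term i (i + d))) ⊞ Σ< (suc Rr) (λ i → Sq q Rr i * (fall i n * X1 (j' + 1)))
      ≈⟨ +-cong mainPart extraPart ⟩
        (Σ< (suc Rr) upper - lowerTerms (suc Rr) α n) ⊞ pow a Rr * X1 (j' + 1)
      ≈⟨ +-congʳ (+-congˡ (-‿cong (≈trans (Σ<-last Rr (λ m → pow a m * X1 (r + 1 ∸ m)))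
                                           (+-congˡ (≡→≈ (cong (λ x → pow a Rr * X1 x) lastIndex)))))) ⟩
        (Σ< (suc Rr) upper - (lowerTerms Rr α n ⊞ pow a Rr * X1 (j' + 1))) ⊞ pow a Rr * X1 (j' + 1)
      ≈⟨ [x-[y+z]]+z (Σ< (suc Rr) upper) (lowerTerms Rr α n) (pow a Rr * X1 (j' + 1)) ⟩
        Σ< (suc Rr) upper - lowerTerms Rr α n
      ∎

module SeriesIdentities {c ℓ} (R : CommutativeRing c ℓ) (q t : CommutativeRing.Carrier R)
         (inv : ℕ → CommutativeRing.Carrier R)
         (inv-qint : ∀ m → CommutativeRing._≈_ R (CommutativeRing._*_ R (Q.qint R q (suc m)) (inv (suc m))) (CommutativeRing.1# R))
         (r' : ℕ) where
  open CommutativeRing R renaming (_+_ to _⊞_; refl to ≈refl; sym to ≈sym; trans to ≈trans)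
  open Q R
  open Q.L R q t inv
  open RingSums R
  open ExponentCode r'
  open FilteredSums R r'
  open Monomials R
  open LiRecurrence R q t inv inv-qint
  open RightHandSide R q t inv r' using (y0; lowerTerms)
  open import Relation.Binary.Reasoning.Setoid setoid

  SerS : (ℕ → List ℕ → Carrier) → Series N
  SerS f α n = Ser (f n) (toℕFun α)

  SerS-ext : ∀ f → Ext (SerS f)
  SerS-ext f α α' h n = Ser-ext (f n) (toℕFun-cong α α' h)

  xmul-SerS : ∀ b (f : ℕ → List ℕ → Carrier) → b < N → ∀ α n →
    xmul (suc b) (SerS f) α n ≈ (if toℕFun α b ≡ᵇ 0 then 0# else Ser (f n) (lowerℕ b (toℕFun α)))
  xmul-SerS b f b<N α n with toFin?-just N b b<N
  ... | p , eq rewrite xmul-just (suc b) (SerS f) α n p eq | cong (maybe α 0) eq with α p ≡ᵇ 0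
  ...   | true = ≈refl
  ...   | false = Ser-ext (f n) (toℕFun-lowerAt b p α eq)

  -- Φ_j (j' = j+1), the δ-part, H_v = Σ Li^t_{(v,kk)} and the raised series Y.
  ΦS NilS Hs : ℕ → Series N
  ΦS j' = SerS (λ n kk → if headOK j' kk then liTCoef kk n else 0#)
  NilS j' = SerS (λ n kk → if isEmptyAt j' kk then liTCoef kk n else 0#)
  Hs v = SerS (λ n kk → liTCoef (v ∷ kk) n)

  Y : Series N
  Y = SerS (λ n kk → if headOK r kk then liTCoef (raise kk) n else 0#)

  y0-ext : Ext y0
  y0-ext α α' h n = ≡→≈ (cong (λ L → ΦCoef r r L n) (Listₚ.map-cong h (allFin N)))

  suffixSums≡sufSums : ∀ xs → suffixSums xs ≡ sufSums xs
  suffixSums≡sufSums [] = refl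
  suffixSums≡sufSums (x ∷ xs) = cong (_ ∷_) (suffixSums≡sufSums xs)

  Φ≋ΦS : ∀ j' → Φ r j' ≋ ΦS j'
  Φ≋ΦS j' α n = ≈trans (≡→≈ (trans (cong (λ L → ΦCoef r j' L n) (map-allFin≡applyUpTo N α)) asG))
                       (heightFiltered≈Ser β (headOK j') (λ kk → liTCoef kk n))
    where
    β = toℕFun α
    asG : ΦCoef r j' (applyUpTo β N) n ≡ G r j' (weightOf β) (depthOf β) (heightsOf β) n
    asG = cong₂ (λ a b → G r j' (β 0 + depthOf β + sumℕ a) (depthOf β) b n) (suffixSums≡sufSums (restOf β)) (suffixSums≡sufSums (restOf β))

  ΦS-split : ∀ j' → j' < r → ΦS j' ≋ (NilS j' ⊕ (xmul (suc (suc j')) (Hs (suc j')) ⊕ ΦS (suc j')))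
  ΦS-split j' j'<r α n =
    ≈trans (Ser-cong (toℕFun α) (head-split j' (λ kk → liTCoef kk n)))
    (≈trans (Ser-+ _ _ (toℕFun α))
    (+-congˡ (≈trans (Ser-+ _ _ (toℕFun α)) (+-congʳ headPart))))
    where
    headPart = ≈trans (Ser-headIs (suc j') (s≤s z≤n) (s≤s (ℕₚ.<⇒≤ j'<r)) (λ kk → liTCoef kk n) (toℕFun α))
                      (≈sym (xmul-SerS (suc j') (λ n kk → liTCoef (suc j' ∷ kk) n) (s≤s (s≤s (ℕₚ.<⇒≤ j'<r))) α n))

  NilS-suc≋0 : ∀ j → NilS (suc j) ≋ zeroS
  NilS-suc≋0 j α n = Ser-0 _ (toℕFun α) nonEmpty
    where
    nonEmpty : ∀ kk → (if isEmptyAt (suc j) kk then liTCoef kk n else 0#) ≈ 0#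
    nonEmpty [] = ≈refl
    nonEmpty (_ ∷ _) = ≈refl

  ΦS-last-split : ΦS r ≋ (xmul (suc (suc r)) (Hs (suc r)) ⊕ xmul 1 Y)
  ΦS-last-split α n =
    ≈trans (Ser-cong (toℕFun α) (head-split r (λ kk → liTCoef kk n)))
    (≈trans (Ser-+ _ _ (toℕFun α))
    (≈trans (+-congʳ (NilS-suc≋0 r' α n))
    (≈trans (+-identityˡ _)
    (≈trans (Ser-+ _ _ (toℕFun α)) (+-cong headPart raisedPart)))))
    where
    headPart = ≈trans (Ser-headIs (suc r) (s≤s z≤n) ℕₚ.≤-refl (λ kk → liTCoef kk n) (toℕFun α))
                      (≈sym (xmul-SerS (suc r) (λ n kk → liTCoef (suc r ∷ kk) n) ℕₚ.≤-refl α n))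
    raisedPart = ≈trans (Ser-raise (λ kk → liTCoef kk n) (toℕFun α))
                        (≈sym (xmul-SerS 0 (λ n kk → if headOK r kk then liTCoef (raise kk) n else 0#) (s≤s z≤n) α n))

  δ≋NilS : ∀ j' → δ r j' ≋ NilS j'
  δ≋NilS zero α n = ≈sym (≈trans (Ser-empty (λ kk → liTCoef kk n) (toℕFun α)) isOne)
    where
    agreeZero : agreeOn N (expOf []) (toℕFun α) ≡ (sumℕ (map α (allFin N)) ≡ᵇ 0)
    agreeZero = trans (agreeOn-zero N (toℕFun α)) (cong (λ L → sumℕ L ≡ᵇ 0) (sym (map-allFin≡applyUpTo N α)))
    isOne : (if agreeOn N (expOf []) (toℕFun α) then liTCoef [] n else 0#) ≈ oneS α n
    isOne rewrite agreeZero with sumℕ (map α (allFin N)) ≡ᵇ 0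
    ... | true = ≈trans (+-identityʳ _) (*-identityʳ _)
    ... | false = ≈refl
  δ≋NilS (suc j) α n = ≈sym (NilS-suc≋0 j α n)

  Hs-recurrence : ∀ v → Hs v ≋ scaleN (qint q) (Hs (suc v))
  Hs-recurrence v α zero = ≈trans (Ser-0 _ (toℕFun α) (λ kk → liTCoef-zero v kk)) (≈sym (zeroˡ _))
  Hs-recurrence v α (suc m) = ≈trans (Ser-cong (toℕFun α) (λ kk → ≈sym (liTCoef-step m v kk))) (Ser-* _ _ (toℕFun α))

  ΦS-last-recurrence : ΦS r ≋ scaleN (qint q) Y
  ΦS-last-recurrence α zero = ≈trans (Ser-0 _ (toℕFun α) vanish) (≈sym (zeroˡ _))
    where
    vanish : ∀ kk → (if headOK r kk then liTCoef kk 0 else 0#) ≈ 0#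
    vanish [] = ≈refl
    vanish (k ∷ kk) with headOK r (k ∷ kk)
    ... | true = liTCoef-zero k kk
    ... | false = ≈refl
  ΦS-last-recurrence α (suc m) = ≈trans (Ser-cong (toℕFun α) step) (Ser-* _ _ (toℕFun α))
    where
    step : ∀ kk → (if headOK r kk then liTCoef kk (suc m) else 0#) ≈ qint q (suc m) * (if headOK r kk then liTCoef (raise kk) (suc m) else 0#)
    step [] = ≈sym (zeroʳ _)
    step (k ∷ kk) with headOK r (k ∷ kk)
    ... | true = ≈sym (liTCoef-step m k kk)
    ... | false = ≈sym (zeroʳ _)

  x1y0 : Series N
  x1y0 = xmul 1 y0

  ∸-suc : ∀ m R → R < m → m ∸ R ≡ suc (m ∸ suc R)
  ∸-suc (suc m) zero _ = refl
  ∸-suc (suc m) (suc R) (s≤s R<m) = ∸-suc m R R<m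

  xTop-Hs : ∀ m → m < r → ∀ α n →
    xmul (suc (suc r)) (Hs (r ∸ m)) α n ≈ pow (qint q n) (suc m) * y0 α n - pow (qint q n) m * x1y0 α n
  xTop-Hs zero _ α n =
    ≈trans (x≈y+z⇒y≈x-z [n]y0) (+-cong (*-congʳ (≈sym (*-identityʳ _))) (-‿cong (≈sym (*-identityˡ _))))
    where
    a = qint q n
    [n]y0 : a * y0 α n ≈ xmul (suc (suc r)) (Hs r) α n ⊞ x1y0 α n
    [n]y0 = begin
        a * y0 α n                                                                   ≈⟨ *-congˡ (Φ≋ΦS r α n) ⟩
        a * ΦS r α n                                                                 ≈⟨ *-congˡ (ΦS-last-split α n) ⟩
        a * (xmul (suc (suc r)) (Hs (suc r)) α n ⊞ xmul 1 Y α n)                     ≈⟨ distribˡ a _ _ ⟩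
        a * xmul (suc (suc r)) (Hs (suc r)) α n ⊞ a * xmul 1 Y α n
          ≈⟨ +-cong (≈sym (xmul-scaleN (suc (suc r)) (qint q) (Hs (suc r)) α n)) (≈sym (xmul-scaleN 1 (qint q) Y α n)) ⟩
        xmul (suc (suc r)) (scaleN (qint q) (Hs (suc r))) α n ⊞ xmul 1 (scaleN (qint q) Y) α n
          ≈⟨ +-cong (xmul-cong (suc (suc r)) (λ α n → ≈sym (Hs-recurrence r α n)) α n)
                    (xmul-cong 1 (λ α n → ≈sym (≈trans (Φ≋ΦS r α n) (ΦS-last-recurrence α n))) α n) ⟩
        xmul (suc (suc r)) (Hs r) α n ⊞ x1y0 α n                                     ∎
  xTop-Hs (suc m) sm<r α n =
    begin
      xmul (suc (suc r)) (Hs v) α n                                  ≈⟨ xmul-cong (suc (suc r)) (Hs-recurrence v) α n ⟩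
      xmul (suc (suc r)) (scaleN (qint q) (Hs (suc v))) α n          ≈⟨ xmul-scaleN (suc (suc r)) (qint q) (Hs (suc v)) α n ⟩
      a * xmul (suc (suc r)) (Hs (suc v)) α n                        ≡⟨ cong (λ x → a * xmul (suc (suc r)) (Hs x) α n) (sym (∸-suc r m m<r)) ⟩
      a * xmul (suc (suc r)) (Hs (r ∸ m)) α n                        ≈⟨ *-congˡ (xTop-Hs m m<r α n) ⟩
      a * (pow a (suc m) * y0 α n - pow a m * x1y0 α n)              ≈⟨ distrib- a (pow a (suc m)) (y0 α n) (pow a m) (x1y0 α n) ⟩
      pow a (suc (suc m)) * y0 α n - pow a (suc m) * x1y0 α n        ∎
    where
    a = qint q n
    v = r ∸ suc m
    m<r : m < r
    m<r = ℕₚ.<-trans (ℕₚ.n<1+n m) sm<r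
    distrib- : ∀ a b y c z → a * (b * y - c * z) ≈ (a * b) * y - (a * c) * z
    distrib- a b y c z = ≈trans (x[y-z]≈xy-xz a (b * y) (c * z)) (+-cong (≈sym (*-assoc a b y)) (-‿cong (≈sym (*-assoc a c z))))

  xTop-xHs : ∀ m → m < r → ∀ b α n →
    xmul (suc (suc r)) (xmul b (Hs (r ∸ m))) α n ≈ pow (qint q n) (suc m) * xmul b y0 α n - pow (qint q n) m * xmul 1 (xmul b y0) α n
  xTop-xHs m m<r b α n =
    begin
      xmul (suc (suc r)) (xmul b (Hs (r ∸ m))) α n                 ≈⟨ xmul-comm (suc (suc r)) b (Hs (r ∸ m)) (SerS-ext _) α n ⟩
      xmul b (xmul (suc (suc r)) (Hs (r ∸ m))) α n                 ≈⟨ xmul-cong b (xTop-Hs m m<r) α n ⟩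
      xmul b (scaleN (λ n → pow (qint q n) (suc m)) y0 ⊖ scaleN (λ n → pow (qint q n) m) x1y0) α n
        ≈⟨ xmul-⊖ b _ _ α n ⟩
      xmul b (scaleN (λ n → pow (qint q n) (suc m)) y0) α n - xmul b (scaleN (λ n → pow (qint q n) m) x1y0) α n
        ≈⟨ +-cong (xmul-scaleN b _ y0 α n) (-‿cong (xmul-scaleN b _ x1y0 α n)) ⟩
      pow a (suc m) * xmul b y0 α n - pow a m * xmul b (xmul 1 y0) α n
        ≈⟨ +-congˡ (-‿cong (*-congˡ (xmul-comm b 1 y0 y0-ext α n))) ⟩
      pow a (suc m) * xmul b y0 α n - pow a m * xmul 1 (xmul b y0) α n ∎
    where
    a = qint q n

  Φ-δ : ℕ → Series N
  Φ-δ j' = Φ r j' ⊖ δ r j'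

  Φ-δ-step : ∀ j' → j' < r → Φ-δ j' ≋ (xmul (suc (suc j')) (Hs (suc j')) ⊕ Φ-δ (suc j'))
  Φ-δ-step j' j'<r α n =
    ≈trans (+-cong (≈trans (Φ≋ΦS j' α n) (ΦS-split j' j'<r α n)) (-‿cong (δ≋NilS j' α n)))
    (≈trans (u+w-u≈w (NilS j' α n) _)
    (+-congˡ (≈sym (≈trans (x-0≈x (Φ r (suc j') α n)) (Φ≋ΦS (suc j') α n)))))

  xTop-Φ-δ : ∀ R → R ≤ r → ∀ α n →
    xmul (suc (suc r)) (Φ-δ (r ∸ R)) α n ≈ Σ< (suc R) (λ m → pow (qint q n) m * xmul (r + 2 ∸ m) y0 α n) - lowerTerms R α n
  xTop-Φ-δ zero _ α n =
    ≈trans (xmul-cong (suc (suc r)) (λ α n → x-0≈x (Φ r r α n)) α n)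
           (≈sym (≈trans (x-0≈x _) (≈trans (+-identityʳ _) (≈trans (*-identityˡ _) (≡→≈ (cong (λ x → xmul x y0 α n) (ℕₚ.+-comm r 2)))))))
  xTop-Φ-δ (suc R) R<r α n =
    begin
      xmul (suc (suc r)) (Φ-δ j) α n                                    ≈⟨ xmul-cong (suc (suc r)) (Φ-δ-step j j<r) α n ⟩
      xmul (suc (suc r)) (xmul (suc (suc j)) (Hs (suc j)) ⊕ Φ-δ (suc j)) α n ≈⟨ xmul-⊕ (suc (suc r)) _ _ α n ⟩
      xmul (suc (suc r)) (xmul (suc (suc j)) (Hs (suc j))) α n ⊞ xmul (suc (suc r)) (Φ-δ (suc j)) α n
        ≈⟨ +-cong newTerm previous ⟩
      (A1 - A2) ⊞ (Σ< (suc R) f - lowerTerms R α n)                     ≈⟨ [x-y]+[u-w] A1 A2 (Σ< (suc R) f) (lowerTerms R α n) ⟩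
      (Σ< (suc R) f ⊞ A1) - (lowerTerms R α n ⊞ A2)                      ≈⟨ +-cong (≈sym (Σ<-last (suc R) f)) (-‿cong (≈sym (Σ<-last R g))) ⟩
      Σ< (suc (suc R)) f - lowerTerms (suc R) α n                        ∎
    where
    a = qint q n
    j = r ∸ suc R
    j+1≡ : r ∸ R ≡ suc j
    j+1≡ = ∸-suc r R R<r
    j<r : j < r
    j<r = subst (_≤ r) j+1≡ (ℕₚ.m∸n≤m r R)
    index1 : r + 1 ∸ R ≡ suc (suc j)
    index1 = trans (ℕₚ.+-∸-comm 1 (ℕₚ.<⇒≤ R<r)) (trans (cong (_+ 1) j+1≡) (ℕₚ.+-comm (suc j) 1))
    index2 : r + 2 ∸ suc R ≡ suc (suc j)
    index2 = trans (cong (_∸ suc R) (ℕₚ.+-suc r 1)) index1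
    f = λ m → pow a m * xmul (r + 2 ∸ m) y0 α n
    g = λ m → pow a m * xmul 1 (xmul (r + 1 ∸ m) y0) α n
    A1 = pow a (suc R) * xmul (r + 2 ∸ suc R) y0 α n
    A2 = pow a R * xmul 1 (xmul (r + 1 ∸ R) y0) α n
    newTerm : xmul (suc (suc r)) (xmul (suc (suc j)) (Hs (suc j))) α n ≈ A1 - A2
    newTerm = begin
        xmul (suc (suc r)) (xmul (suc (suc j)) (Hs (suc j))) α n
          ≡⟨ cong₂ (λ b v → xmul (suc (suc r)) (xmul b (Hs v)) α n) (sym index1) (sym j+1≡) ⟩
        xmul (suc (suc r)) (xmul (r + 1 ∸ R) (Hs (r ∸ R))) α n
          ≈⟨ xTop-xHs R R<r (r + 1 ∸ R) α n ⟩
        pow a (suc R) * xmul (r + 1 ∸ R) y0 α n - A2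
          ≡⟨ cong (λ b → pow a (suc R) * xmul b y0 α n - A2) (trans index1 (sym index2)) ⟩
        A1 - A2 ∎
    previous : xmul (suc (suc r)) (Φ-δ (suc j)) α n ≈ Σ< (suc R) f - lowerTerms R α n
    previous = ≈trans (≡→≈ (cong (λ x → xmul (suc (suc r)) (Φ-δ x) α n) (sym j+1≡))) (xTop-Φ-δ R (ℕₚ.<⇒≤ R<r) α n)

theorem3p8 : ∀ {c ℓ} (R : CommutativeRing c ℓ) (q t : CommutativeRing.Carrier R)
               (inv : ℕ → CommutativeRing.Carrier R) →
             (∀ m → CommutativeRing._≈_ R (CommutativeRing._*_ R (Q.qint R q (suc m)) (inv (suc m))) (CommutativeRing.1# R)) →
             (r : ℕ) → 1 ≤ r → (j' : ℕ) → j' ≤ r →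
             Q._≋_ R (Q.xmul R (r + 2) (Q._⊖_ R (Q.L.Φ R q t inv r j') (Q.L.δ R q t inv r j')))
                     (Q.L.RHS R q t inv r j')
theorem3p8 R q t inv inv-qint zero () j' j'≤r
theorem3p8 R q t inv inv-qint r@(suc r') _ j' j'≤r α n =
  begin
    xmul (r + 2) (Φ-δ j') α n                            ≡⟨ cong₂ (λ a j → xmul a (Φ-δ j) α n) (ℕₚ.+-comm r 2) (sym (ℕₚ.m∸[m∸n]≡n j'≤r)) ⟩
    xmul (suc (suc r)) (Φ-δ (r ∸ (r ∸ j'))) α n          ≈⟨ xTop-Φ-δ (r ∸ j') (ℕₚ.m∸n≤m r j') α n ⟩
    Σ< (suc (r ∸ j')) (λ m → pow (qint q n) m * xmul (r + 2 ∸ m) y0 α n) - lowerTerms (r ∸ j') α n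
                                                         ≈⟨ CommutativeRing.sym R (Collapse.RHS-collapse j' j'≤r α n) ⟩
    RHS r j' α n                                         ∎
  where
  open CommutativeRing R using (_-_; _*_)
  open Q R
  open Q.L R q t inv
  open RingSums R using (Σ<)
  open SeriesIdentities R q t inv inv-qint r'
  open RightHandSide R q t inv r'
  open import Relation.Binary.Reasoning.Setoid (CommutativeRing.setoid R)
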